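{- Let $n$ be a nonnegative integer and let $x$ be a complex number for which all the expressions below are defined. Then \begin{align*} &\sum_{k=0}^{n}(-1)^k\binom{n}{k} \frac{\binom{\frac{x}{2}+k}{k}\binom{x-\frac{1}{2}+k}{k}}{\binom{\frac{x-1}{2}+k}{k}\binom{x-\frac{1}{2}+n+k}{k}}H_{2k}(x)\\ &=4^{n-1}\frac{\binom{\frac{x}{2}-\frac{1}{4}+n}{n}\binom{ -\frac{3}{4}+n}{n}}{\binom{\frac{x-1}{2}+n}{n}\binom{x-\frac{1}{2}+2n}{n}} \big\{H_n(\tfrac{x-1}{2})-H_n(-\tfrac{3}{4})\big\} +4^{n-1}\frac{\binom{\frac{x}{2}-\frac{3}{4}+n}{n}\binom{ -\frac{5}{4}+n}{n}}{\binom{\frac{x-1}{2}+n}{n}\binom{x-\frac{1}{2}+2n}{n}} \big\{H_n(\tfrac{x-1}{2})-H_n(-\tfrac{5}{4})\big\}. \end{align*}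
   Context: For a complex number $z$ and a nonnegative integer $t$, $\binom{z}{t}=\frac{z(z-1)\cdots(z-t+1)}{t!}$ (with $\binom{z}{0}=1$). For complex $x$, $H_0(x)=0$ and $H_m(x)=\sum_{j=1}^m\frac{1}{x+j}$ for $m\ge1$. -}

module Defs where

open import Level using (Level; suc; _⊔_)
open import Data.Nat as ℕ using (ℕ; zero; _!)
open import Relation.Nullary using (¬_)
open import Algebra.Bundles using (CommutativeRing)

natR : ∀ {c ℓ} (R : CommutativeRing c ℓ) → ℕ → CommutativeRing.Carrier R
natR R zero = CommutativeRing.0# R
natR R (ℕ.suc n) = CommutativeRing._+_ R (CommutativeRing.1# R) (natR R n)

-- A field of characteristic zero (e.g. ℂ), with a total inverse function
-- (convention 0⁻¹ = 0; the statement only ever inverts elements assumed nonzero).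
record CharZeroField (c ℓ : Level) : Set (suc (c ⊔ ℓ)) where
  field
    commRing : CommutativeRing c ℓ
  open CommutativeRing commRing public
  field
    _⁻¹      : Carrier → Carrier
    ⁻¹-cong  : ∀ {x y} → x ≈ y → x ⁻¹ ≈ y ⁻¹
    inverseʳ : ∀ x → ¬ (x ≈ 0#) → x * x ⁻¹ ≈ 1#
    0⁻¹      : 0# ⁻¹ ≈ 0#
    charZero : ∀ n → ¬ (natR commRing (ℕ.suc n) ≈ 0#)
  infix 8 _⁻¹

module FieldOps {c ℓ} (F : CharZeroField c ℓ) where
  open CharZeroField F

  ι : ℕ → Carrier
  ι = natR commRing

  _÷_ : Carrier → Carrier → Carrier
  a ÷ b = a * b ⁻¹
  infixl 7 _÷_

  pow : Carrier → ℕ → Carrier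
  pow a zero = 1#
  pow a (ℕ.suc n) = a * pow a n

  sgn : ℕ → Carrier
  sgn zero = 1#
  sgn (ℕ.suc k) = - (sgn k)

  sumTo : ℕ → (ℕ → Carrier) → Carrier
  sumTo zero f = f 0
  sumTo (ℕ.suc n) f = sumTo n f + f (ℕ.suc n)

  falling : Carrier → ℕ → Carrier
  falling z zero = 1#
  falling z (ℕ.suc t) = falling z t * (z - ι t)

  binom : Carrier → ℕ → Carrier
  binom z t = falling z t ÷ ι (t !)

  H : ℕ → Carrier → Carrier
  H zero x = 0#
  H (ℕ.suc m) x = H m x + (x + ι (ℕ.suc m)) ⁻¹

{-# OPTIONS --safe #-}
-- With a = c - 2p and b = 2c - 2p - 1, the terminating sums
--   Sₑ(n) = ∑ₖ (-1)ᵏ C(n,k) (a)ₖ (b)ₖ (c+k)ₙ₋ₖ (b+n+k+e)ₙ₋ₖ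
-- satisfy S₁(n) = ∏_{i<n} 2(2p+1+2i)(c-p+i) and 2S₀(n) - S₁(n) = ∏_{i<n} 2(p+i)(b+2i),
-- over any commutative ring in which the positive integers cancel: in each case a
-- Zeilberger certificate makes the defect of the first-order recurrence in n telescope.
-- Evaluating 2S₀(n) = S₁(n) + (2S₀(n) - S₁(n)) over the dual numbers at p = -¼ + ε/2,
-- c = (x+1)/2 + ε/2 and comparing ε-coefficients differentiates it. The logarithmic
-- derivative of a rising factorial is a sum of reciprocals, so the derivative of the k-th
-- summand is the summand times ½ H_n((x-1)/2) - H_{2k}(x), and the derivatives of the
-- two products give H_n(-3/4) and H_n(-5/4). Eliminating the underived sum and dividing
-- by (c)ₙ (b+n)ₙ turns rising factorials into the binomial coefficients of the statement.
module Submission where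

open import Level using (_⊔_)
open import Algebra.Bundles using (CommutativeRing)
open import Algebra.Structures using (IsCommutativeRing)
import Algebra.Solver.Ring.AlmostCommutativeRing as ACR
open import Data.Nat as ℕ using (ℕ; zero; suc; _∸_; _<_; _≤_; z≤n; s≤s; _!)
import Data.Nat.Properties as ℕ
open import Data.Nat.Combinatorics using (_C_; nCk+nC[k+1]≡[n+1]C[k+1]; k>n⇒nCk≡0; nC1≡n; nCn≡1)
open import Data.Integer as ℤ using (ℤ; +_; -[1+_]; _⊖_; _◃_; sign; ∣_∣)
import Data.Integer.Properties as ℤ
open import Data.Sign as Sign using (Sign)
open import Data.Maybe using (Maybe; just; nothing)
open import Data.Product using (_×_; _,_; proj₁; proj₂)
open import Function using (_∘_; _∘′_)
open import Relation.Nullary using (¬_; yes; no)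
open import Relation.Binary.PropositionalEquality as ≡ using (_≡_)
open import Defs

module ℤ-RingSolver {c ℓ} (R : CommutativeRing c ℓ) where
  open CommutativeRing R
  open import Algebra.Properties.Ring ring using (-‿involutive; -0#≈0#; -‿+-comm; -1*x≈-x)
  open import Algebra.Properties.CommutativeSemigroup *-commutativeSemigroup using (interchange)
  open import Algebra.Properties.Semiring.Mult.TCOptimised semiring
    using (×-homo-+; ×1-homo-*) renaming (_×_ to _×′_)
  open import Relation.Binary.Reasoning.Setoid setoid

  -- The optimised _×′_ makes the numerals 0, 1 and 2 denote 0#, 1# and 1# + 1# literally,
  -- so that solver equations match goals up to definitional equality.
  fromℕ : ℕ → Carrier
  fromℕ n = n ×′ 1#

  fromℤ : ℤ → Carrier
  fromℤ (+ n)    = fromℕ n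
  fromℤ -[1+ n ] = - fromℕ (suc n)

  fromSign : Sign → Carrier
  fromSign Sign.+ = 1#
  fromSign Sign.- = - 1#

  fromSign-homo-* : ∀ s t → fromSign (s Sign.* t) ≈ fromSign s * fromSign t
  fromSign-homo-* Sign.+ t      = sym (*-identityˡ _)
  fromSign-homo-* Sign.- Sign.+ = sym (*-identityʳ _)
  fromSign-homo-* Sign.- Sign.- = begin
    1#            ≈⟨ -‿involutive 1# ⟨
    - - 1#        ≈⟨ -1*x≈-x (- 1#) ⟨
    - 1# * - 1#   ∎

  fromℤ-◃ : ∀ s n → fromℤ (s ◃ n) ≈ fromSign s * fromℕ n
  fromℤ-◃ s      zero    = sym (zeroʳ _)
  fromℤ-◃ Sign.+ (suc n) = sym (*-identityˡ _)
  fromℤ-◃ Sign.- (suc n) = sym (-1*x≈-x _)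

  fromℤ-neg+ : ∀ n → fromℤ (ℤ.- + n) ≈ - fromℕ n
  fromℤ-neg+ zero    = sym -0#≈0#
  fromℤ-neg+ (suc n) = refl

  fromℕ-suc : ∀ n → fromℕ (suc n) ≈ 1# + fromℕ n
  fromℕ-suc n = ×-homo-+ 1# 1 n

  [a+x]-[a+y]≈x-y : ∀ a x y → (a + x) - (a + y) ≈ x - y
  [a+x]-[a+y]≈x-y a x y = begin
    (a + x) - (a + y)        ≈⟨ +-congˡ (-‿+-comm a y) ⟨
    (a + x) + (- a + - y)    ≈⟨ +-congʳ (+-comm a x) ⟩
    (x + a) + (- a + - y)    ≈⟨ +-assoc x a _ ⟩
    x + (a + (- a + - y))    ≈⟨ +-congˡ (+-assoc a (- a) (- y)) ⟨
    x + ((a - a) + - y)      ≈⟨ +-congˡ (+-congʳ (-‿inverseʳ a)) ⟩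
    x + (0# + - y)           ≈⟨ +-congˡ (+-identityˡ (- y)) ⟩
    x - y                    ∎

  fromℤ-⊖ : ∀ m n → fromℤ (m ⊖ n) ≈ fromℕ m - fromℕ n
  fromℤ-⊖ zero    zero    = sym (-‿inverseʳ 0#)
  fromℤ-⊖ zero    (suc n) = sym (+-identityˡ _)
  fromℤ-⊖ (suc m) zero    = sym (trans (+-congˡ -0#≈0#) (+-identityʳ _))
  fromℤ-⊖ (suc m) (suc n) = begin
    fromℤ (suc m ⊖ suc n)              ≡⟨ ≡.cong fromℤ (ℤ.[1+m]⊖[1+n]≡m⊖n m n) ⟩
    fromℤ (m ⊖ n)                      ≈⟨ fromℤ-⊖ m n ⟩
    fromℕ m - fromℕ n                  ≈⟨ [a+x]-[a+y]≈x-y 1# (fromℕ m) (fromℕ n) ⟨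
    (1# + fromℕ m) - (1# + fromℕ n)    ≈⟨ +-cong (fromℕ-suc m) (-‿cong (fromℕ-suc n)) ⟨
    fromℕ (suc m) - fromℕ (suc n)      ∎

  fromℤ-homo-+ : ∀ i j → fromℤ (i ℤ.+ j) ≈ fromℤ i + fromℤ j
  fromℤ-homo-+ (+ m)    (+ n)    = ×-homo-+ 1# m n
  fromℤ-homo-+ (+ m)    -[1+ n ] = fromℤ-⊖ m (suc n)
  fromℤ-homo-+ -[1+ m ] (+ n)    = trans (fromℤ-⊖ n (suc m)) (+-comm _ _)
  fromℤ-homo-+ -[1+ m ] -[1+ n ] = begin
    - fromℕ (suc (suc (m ℕ.+ n)))       ≡⟨ ≡.cong (λ k → - fromℕ (suc k)) (ℕ.+-suc m n) ⟨
    - fromℕ (suc m ℕ.+ suc n)           ≈⟨ -‿cong (×-homo-+ 1# (suc m) (suc n)) ⟩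
    - (fromℕ (suc m) + fromℕ (suc n))   ≈⟨ -‿+-comm _ _ ⟨
    - fromℕ (suc m) + - fromℕ (suc n)   ∎

  fromℤ-homo-* : ∀ i j → fromℤ (i ℤ.* j) ≈ fromℤ i * fromℤ j
  fromℤ-homo-* i j = begin
    fromℤ (sign i Sign.* sign j ◃ ∣ i ∣ ℕ.* ∣ j ∣)          ≈⟨ fromℤ-◃ (sign i Sign.* sign j) (∣ i ∣ ℕ.* ∣ j ∣) ⟩
    fromSign (sign i Sign.* sign j) * fromℕ (∣ i ∣ ℕ.* ∣ j ∣)
      ≈⟨ *-cong (fromSign-homo-* (sign i) (sign j)) (×1-homo-* ∣ i ∣ ∣ j ∣) ⟩
    (fromSign (sign i) * fromSign (sign j)) * (fromℕ ∣ i ∣ * fromℕ ∣ j ∣)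
      ≈⟨ interchange _ _ _ _ ⟩
    (fromSign (sign i) * fromℕ ∣ i ∣) * (fromSign (sign j) * fromℕ ∣ j ∣)
      ≈⟨ *-cong (fromℤ-◃-inverse i) (fromℤ-◃-inverse j) ⟨
    fromℤ i * fromℤ j                                        ∎
    where
    fromℤ-◃-inverse : ∀ i → fromℤ i ≈ fromSign (sign i) * fromℕ ∣ i ∣
    fromℤ-◃-inverse i = trans (reflexive (≡.cong fromℤ (≡.sym (ℤ.◃-inverse i)))) (fromℤ-◃ (sign i) ∣ i ∣)

  fromℤ-homo-- : ∀ i → fromℤ (ℤ.- i) ≈ - fromℤ i
  fromℤ-homo-- (+ n)    = fromℤ-neg+ n
  fromℤ-homo-- -[1+ n ] = sym (-‿involutive _)

  fromℤ-morphism : ℤ.+-*-rawRing ACR.-Raw-AlmostCommutative⟶ ACR.fromCommutativeRing R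
  fromℤ-morphism = record
    { ⟦_⟧ = fromℤ ; +-homo = fromℤ-homo-+ ; *-homo = fromℤ-homo-* ; -‿homo = fromℤ-homo--
    ; 0-homo = refl ; 1-homo = refl }

  fromℤ-equal? : ∀ i j → Maybe (fromℤ i ≈ fromℤ j)
  fromℤ-equal? i j with i ℤ.≟ j
  ... | yes ≡.refl = just refl
  ... | no _       = nothing

  open import Algebra.Solver.Ring ℤ.+-*-rawRing (ACR.fromCommutativeRing R) fromℤ-morphism fromℤ-equal? public

module _ where
  open import Data.Nat using (_+_; _*_)
  open import Data.Nat.Properties using (+-suc; +-comm; +-assoc; +-identityʳ; *-distribˡ-+; *-zeroʳ; *-identityʳ)

  infixl 6.5 _C⁻_
  _C⁻_ : ℕ → ℕ → ℕ
  n C⁻ zero  = 0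
  n C⁻ suc k = n C k

  [1+n]Ck≡nCk+nC⁻k : ∀ n k → suc n C k ≡ n C k + n C⁻ k
  [1+n]Ck≡nCk+nC⁻k n zero    = ≡.refl
  [1+n]Ck≡nCk+nC⁻k n (suc k) = ≡.trans (≡.sym (nCk+nC[k+1]≡[n+1]C[k+1] n k)) (+-comm (n C k) (n C suc k))

  [1+k]*[1+n]C[1+k]≡[1+n]*nCk : ∀ n k → suc k * (suc n C suc k) ≡ suc n * (n C k)
  [1+k]*[1+n]C[1+k]≡[1+n]*nCk zero    zero    = ≡.refl
  [1+k]*[1+n]C[1+k]≡[1+n]*nCk zero    (suc k)
    rewrite k>n⇒nCk≡0 {1} {suc (suc k)} (s≤s (s≤s z≤n)) | k>n⇒nCk≡0 {0} {suc k} (s≤s z≤n) = *-zeroʳ (suc (suc k))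
  [1+k]*[1+n]C[1+k]≡[1+n]*nCk (suc n) zero
    rewrite nC1≡n (suc (suc n)) = ≡.trans (+-identityʳ (suc (suc n))) (≡.sym (*-identityʳ (suc (suc n))))
  [1+k]*[1+n]C[1+k]≡[1+n]*nCk (suc n) (suc k) = begin
    suc (suc k) * (suc (suc n) C suc (suc k))
      ≡⟨ ≡.cong (suc (suc k) *_) (nCk+nC[k+1]≡[n+1]C[k+1] (suc n) (suc k)) ⟨
    suc (suc k) * (suc n C suc k + suc n C suc (suc k))
      ≡⟨ *-distribˡ-+ (suc (suc k)) (suc n C suc k) _ ⟩
    suc (suc k) * (suc n C suc k) + suc (suc k) * (suc n C suc (suc k))
      ≡⟨ ≡.cong₂ (λ a b → suc n C suc k + a + b)
           ([1+k]*[1+n]C[1+k]≡[1+n]*nCk n k) ([1+k]*[1+n]C[1+k]≡[1+n]*nCk n (suc k)) ⟩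
    suc n C suc k + suc n * (n C k) + suc n * (n C suc k)
      ≡⟨ +-assoc (suc n C suc k) _ _ ⟩
    suc n C suc k + (suc n * (n C k) + suc n * (n C suc k))
      ≡⟨ ≡.cong (λ z → suc n C suc k + z) (*-distribˡ-+ (suc n) (n C k) (n C suc k)) ⟨
    suc n C suc k + suc n * (n C k + n C suc k)
      ≡⟨ ≡.cong (λ z → suc n C suc k + suc n * z) (nCk+nC[k+1]≡[n+1]C[k+1] n k) ⟩
    suc (suc n) * (suc n C suc k) ∎
    where open ≡.≡-Reasoning

  k*nCk+k*nC⁻k≡[1+n]*nC⁻k : ∀ n k → k * (n C k) + k * (n C⁻ k) ≡ suc n * (n C⁻ k)
  k*nCk+k*nC⁻k≡[1+n]*nC⁻k n zero    = ≡.sym (*-zeroʳ (suc n))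
  k*nCk+k*nC⁻k≡[1+n]*nC⁻k n (suc k) = begin
    suc k * (n C suc k) + suc k * (n C k)  ≡⟨ *-distribˡ-+ (suc k) (n C suc k) (n C k) ⟨
    suc k * (n C suc k + n C k)            ≡⟨ ≡.cong (suc k *_) (+-comm (n C suc k) (n C k)) ⟩
    suc k * (n C k + n C suc k)            ≡⟨ ≡.cong (suc k *_) (nCk+nC[k+1]≡[n+1]C[k+1] n k) ⟩
    suc k * (suc n C suc k)                ≡⟨ [1+k]*[1+n]C[1+k]≡[1+n]*nCk n k ⟩
    suc n * (n C k)                        ∎
    where open ≡.≡-Reasoning

  2*[1+k]≡2+2*k : ∀ k → 2 * suc k ≡ suc (suc (2 * k))
  2*[1+k]≡2+2*k k = ≡.cong suc (+-suc k (k + 0))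

module RingBasics {c ℓ} (R : CommutativeRing c ℓ) where
  open CommutativeRing R
  open ℤ-RingSolver R
  open import Algebra.Properties.Ring ring using (x∙y⁻¹≈ε⇒x≈y)
  open import Relation.Binary.Reasoning.Setoid setoid

  ι : ℕ → Carrier
  ι = natR R

  ιₛ : ∀ {n} → ℕ → Polynomial n
  ιₛ zero    = con (+ 0)
  ιₛ (suc k) = con (+ 1) :+ ιₛ k

  NaturalsCancellative : Set (c ⊔ ℓ)
  NaturalsCancellative = ∀ m {y} → ι (suc m) * y ≈ 0# → y ≈ 0#

  ι-homo-+ : ∀ m n → ι (m ℕ.+ n) ≈ ι m + ι n
  ι-homo-+ zero    n = sym (+-identityˡ _)
  ι-homo-+ (suc m) n = trans (+-congˡ (ι-homo-+ m n)) (sym (+-assoc _ _ _))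

  ι-homo-* : ∀ m n → ι (m ℕ.* n) ≈ ι m * ι n
  ι-homo-* zero    n = sym (zeroˡ _)
  ι-homo-* (suc m) n = begin
    ι (n ℕ.+ m ℕ.* n)          ≈⟨ ι-homo-+ n (m ℕ.* n) ⟩
    ι n + ι (m ℕ.* n)          ≈⟨ +-cong (sym (*-identityˡ _)) (ι-homo-* m n) ⟩
    1# * ι n + ι m * ι n       ≈⟨ distribʳ _ _ _ ⟨
    (1# + ι m) * ι n           ∎

  rising : Carrier → ℕ → Carrier
  rising u zero    = 1#
  rising u (suc m) = rising u m * (u + ι m)

  rising-cong : ∀ {u v} m → u ≈ v → rising u m ≈ rising v m
  rising-cong zero    u≈v = refl
  rising-cong (suc m) u≈v = *-cong (rising-cong m u≈v) (+-congʳ u≈v)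

  rising-≡ : ∀ u {m n} → m ≡ n → rising u m ≈ rising u n
  rising-≡ u m≡n = reflexive (≡.cong (rising u) m≡n)

  rising-1 : ∀ u → rising u 1 ≈ u
  rising-1 = solve 1 (λ u → con (+ 1) :* (u :+ con (+ 0)) := u) refl

  rising-suc : ∀ u m → rising u (suc m) ≈ u * rising (u + 1#) m
  rising-suc u zero    = solve 1 (λ u → con (+ 1) :* (u :+ con (+ 0)) := u :* con (+ 1)) refl u
  rising-suc u (suc m) = begin
    rising u (suc m) * (u + ι (suc m))                ≈⟨ *-congʳ (rising-suc u m) ⟩
    (u * rising (u + 1#) m) * (u + (1# + ι m))        ≈⟨ shift (rising (u + 1#) m) u (ι m) ⟩
    u * (rising (u + 1#) m * ((u + 1#) + ι m))        ∎
    where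
    shift : ∀ r u m → (u * r) * (u + (1# + m)) ≈ u * (r * ((u + 1#) + m))
    shift = solve 3 (λ r u m → (u :* r) :* (u :+ (con (+ 1) :+ m)) := u :* (r :* ((u :+ con (+ 1)) :+ m))) refl

  rising-+ : ∀ u k m → rising u (k ℕ.+ m) ≈ rising u k * rising (u + ι k) m
  rising-+ u k zero    = trans (rising-≡ u (ℕ.+-identityʳ k)) (sym (*-identityʳ _))
  rising-+ u k (suc m) = begin
    rising u (k ℕ.+ suc m)                              ≈⟨ rising-≡ u (ℕ.+-suc k m) ⟩
    rising u (k ℕ.+ m) * (u + ι (k ℕ.+ m))              ≈⟨ *-cong (rising-+ u k m) (+-congˡ (ι-homo-+ k m)) ⟩
    rising u k * rising (u + ι k) m * (u + (ι k + ι m)) ≈⟨ reassoc (rising u k) (rising (u + ι k) m) u (ι k) (ι m) ⟩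
    rising u k * (rising (u + ι k) m * ((u + ι k) + ι m)) ∎
    where
    reassoc : ∀ a b u k m → a * b * (u + (k + m)) ≈ a * (b * ((u + k) + m))
    reassoc = solve 5 (λ a b u k m → a :* b :* (u :+ (k :+ m)) := a :* (b :* ((u :+ k) :+ m))) refl

  ∑< : (ℕ → Carrier) → ℕ → Carrier
  ∑< f zero    = 0#
  ∑< f (suc m) = ∑< f m + f m

  ∏< : (ℕ → Carrier) → ℕ → Carrier
  ∏< f zero    = 1#
  ∏< f (suc m) = ∏< f m * f m

  ∑<-cong : ∀ {f g} m → (∀ k → k < m → f k ≈ g k) → ∑< f m ≈ ∑< g m
  ∑<-cong zero    f≈g = refl
  ∑<-cong (suc m) f≈g = +-cong (∑<-cong m (λ k k<m → f≈g k (ℕ.m<n⇒m<1+n k<m))) (f≈g m ℕ.≤-refl)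

  ∑<-linear : ∀ u v (f g : ℕ → Carrier) m → ∑< (λ k → u * f k + v * g k) m ≈ u * ∑< f m + v * ∑< g m
  ∑<-linear u v f g zero    = solve 2 (λ u v → con (+ 0) := u :* con (+ 0) :+ v :* con (+ 0)) refl u v
  ∑<-linear u v f g (suc m) = begin
    ∑< (λ k → u * f k + v * g k) m + (u * f m + v * g m)  ≈⟨ +-congʳ (∑<-linear u v f g m) ⟩
    (u * ∑< f m + v * ∑< g m) + (u * f m + v * g m)      ≈⟨ collect u v (∑< f m) (∑< g m) (f m) (g m) ⟩
    u * (∑< f m + f m) + v * (∑< g m + g m)               ∎
    where
    collect : ∀ u v a b c d → (u * a + v * b) + (u * c + v * d) ≈ u * (a + c) + v * (b + d)
    collect = solve 6 (λ u v a b c d → (u :* a :+ v :* b) :+ (u :* c :+ v :* d) := u :* (a :+ c) :+ v :* (b :+ d)) refl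

  ∑<-distrib-+ : ∀ (f g : ℕ → Carrier) m → ∑< (λ k → f k + g k) m ≈ ∑< f m + ∑< g m
  ∑<-distrib-+ f g zero    = sym (+-identityˡ 0#)
  ∑<-distrib-+ f g (suc m) = trans (+-congʳ (∑<-distrib-+ f g m))
    (solve 4 (λ a b c d → (a :+ b) :+ (c :+ d) := (a :+ c) :+ (b :+ d)) refl (∑< f m) (∑< g m) (f m) (g m))

  ∑<-distribˡ-* : ∀ u (f : ℕ → Carrier) m → ∑< (λ k → u * f k) m ≈ u * ∑< f m
  ∑<-distribˡ-* u f zero    = sym (zeroʳ u)
  ∑<-distribˡ-* u f (suc m) = trans (+-congʳ (∑<-distribˡ-* u f m)) (sym (distribˡ u _ _))

  ∑<-+ : ∀ (f : ℕ → Carrier) k m → ∑< f (k ℕ.+ m) ≈ ∑< f k + ∑< (λ i → f (k ℕ.+ i)) m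
  ∑<-+ f k zero    = trans (reflexive (≡.cong (∑< f) (ℕ.+-identityʳ k))) (sym (+-identityʳ _))
  ∑<-+ f k (suc m) = begin
    ∑< f (k ℕ.+ suc m)                                        ≡⟨ ≡.cong (∑< f) (ℕ.+-suc k m) ⟩
    ∑< f (k ℕ.+ m) + f (k ℕ.+ m)                              ≈⟨ +-congʳ (∑<-+ f k m) ⟩
    (∑< f k + ∑< (λ i → f (k ℕ.+ i)) m) + f (k ℕ.+ m)        ≈⟨ +-assoc _ _ _ ⟩
    ∑< f k + (∑< (λ i → f (k ℕ.+ i)) m + f (k ℕ.+ m))        ∎

  ∑<-telescope : ∀ (f g : ℕ → Carrier) m → (∀ k → k < m → f k ≈ g (suc k) - g k) → ∑< f m ≈ g m - g 0
  ∑<-telescope f g zero    _  = sym (-‿inverseʳ (g 0))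
  ∑<-telescope f g (suc m) eq = begin
    ∑< f m + f m                    ≈⟨ +-cong (∑<-telescope f g m (λ k k<m → eq k (ℕ.m<n⇒m<1+n k<m))) (eq m ℕ.≤-refl) ⟩
    (g m - g 0) + (g (suc m) - g m) ≈⟨ solve 3 (λ a b c → (a :- b) :+ (c :- a) := c :- b) refl (g m) (g 0) (g (suc m)) ⟩
    g (suc m) - g 0                 ∎

  ∑<-first-order : ∀ (f : ℕ → ℕ → Carrier) ρ n → f n (suc n) ≈ 0# →
                   ∑< (λ k → f (suc n) k - ρ * f n k) (suc (suc n)) ≈ 0# →
                   ∑< (f (suc n)) (suc (suc n)) ≈ ρ * ∑< (f n) (suc n)
  ∑<-first-order f ρ n top≈0 ∑defect≈0 = x∙y⁻¹≈ε⇒x≈y _ _ (begin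
    ∑< (f (suc n)) (suc (suc n)) - ρ * ∑< (f n) (suc n)
      ≈⟨ +-congˡ (-‿cong (*-congˡ (trans (sym (+-identityʳ _)) (+-congˡ (sym top≈0))))) ⟩
    ∑< (f (suc n)) (suc (suc n)) - ρ * ∑< (f n) (suc (suc n))
      ≈⟨ solve 3 (λ s r t → s :- r :* t := con (+ 1) :* s :+ (:- r) :* t) refl _ ρ _ ⟩
    1# * ∑< (f (suc n)) (suc (suc n)) + (- ρ) * ∑< (f n) (suc (suc n))
      ≈⟨ ∑<-linear 1# (- ρ) (f (suc n)) (f n) (suc (suc n)) ⟨
    ∑< (λ k → 1# * f (suc n) k + (- ρ) * f n k) (suc (suc n))
      ≈⟨ ∑<-cong (suc (suc n)) (λ k _ → solve 3 (λ a r b → con (+ 1) :* a :+ (:- r) :* b := a :- r :* b) refl _ ρ _) ⟩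
    ∑< (λ k → f (suc n) k - ρ * f n k) (suc (suc n))
      ≈⟨ ∑defect≈0 ⟩
    0# ∎)

module DualNumbers {c ℓ} (R : CommutativeRing c ℓ) where
  open CommutativeRing R
  open ℤ-RingSolver R

  -- R[ε] with ε² = 0: the pair (a , b) stands for a + b ε.
  infix  4 _≈ε_
  infixl 6 _+ε_
  infixl 7 _*ε_

  _≈ε_ : Carrier × Carrier → Carrier × Carrier → Set ℓ
  (a , b) ≈ε (a′ , b′) = (a ≈ a′) × (b ≈ b′)

  _+ε_ _*ε_ : Carrier × Carrier → Carrier × Carrier → Carrier × Carrier
  (a , b) +ε (a′ , b′) = (a + a′ , b + b′)
  (a , b) *ε (a′ , b′) = (a * a′ , a * b′ + b * a′)

  -ε_ : Carrier × Carrier → Carrier × Carrier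
  -ε (a , b) = (- a , - b)

  isCommutativeRingε : IsCommutativeRing _≈ε_ _+ε_ _*ε_ -ε_ (0# , 0#) (1# , 0#)
  isCommutativeRingε = record
    { isRing = record
      { +-isAbelianGroup = record
        { isGroup = record
          { isMonoid = record
            { isSemigroup = record
              { isMagma = record
                { isEquivalence = record
                  { refl  = refl , refl
                  ; sym   = λ { (e , f) → sym e , sym f }
                  ; trans = λ { (e , f) (e′ , f′) → trans e e′ , trans f f′ } }
                ; ∙-cong = λ { (e , f) (e′ , f′) → +-cong e e′ , +-cong f f′ } }
              ; assoc = λ { (a , b) (a′ , b′) (a″ , b″) → +-assoc a a′ a″ , +-assoc b b′ b″ } }
            ; identity = (λ { (a , b) → +-identityˡ a , +-identityˡ b })
                       , (λ { (a , b) → +-identityʳ a , +-identityʳ b }) }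
          ; inverse = (λ { (a , b) → -‿inverseˡ a , -‿inverseˡ b })
                    , (λ { (a , b) → -‿inverseʳ a , -‿inverseʳ b })
          ; ⁻¹-cong = λ { (e , f) → -‿cong e , -‿cong f } }
        ; comm = λ { (a , b) (a′ , b′) → +-comm a a′ , +-comm b b′ } }
      ; *-cong = λ { (e , f) (e′ , f′) → *-cong e e′ , +-cong (*-cong e f′) (*-cong f e′) }
      ; *-assoc = λ { (a , b) (a′ , b′) (a″ , b″) → *-assoc a a′ a″ ,
          solve 6 (λ a b a′ b′ a″ b″ → (a :* a′) :* b″ :+ (a :* b′ :+ b :* a′) :* a″
                                     := a :* (a′ :* b″ :+ b′ :* a″) :+ b :* (a′ :* a″)) refl a b a′ b′ a″ b″ }
      ; *-identity = (λ { (a , b) → *-identityˡ a , solve 2 (λ a b → con (+ 1) :* b :+ con (+ 0) :* a := b) refl a b })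
                   , (λ { (a , b) → *-identityʳ a , solve 2 (λ a b → a :* con (+ 0) :+ b :* con (+ 1) := b) refl a b })
      ; distrib = (λ { (a , b) (a′ , b′) (a″ , b″) → distribˡ a a′ a″ ,
                      solve 6 (λ a b a′ b′ a″ b″ → a :* (b′ :+ b″) :+ b :* (a′ :+ a″)
                                                 := (a :* b′ :+ b :* a′) :+ (a :* b″ :+ b :* a″)) refl a b a′ b′ a″ b″ })
                , (λ { (a , b) (a′ , b′) (a″ , b″) → distribʳ a a′ a″ ,
                      solve 6 (λ a b a′ b′ a″ b″ → (a′ :+ a″) :* b :+ (b′ :+ b″) :* a
                                                 := (a′ :* b :+ b′ :* a) :+ (a″ :* b :+ b″ :* a)) refl a b a′ b′ a″ b″ }) }
    ; *-comm = λ { (a , b) (a′ , b′) → *-comm a a′ ,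
        solve 4 (λ a b a′ b′ → a :* b′ :+ b :* a′ := a′ :* b :+ b′ :* a) refl a b a′ b′ } }

  R[ε] : CommutativeRing c ℓ
  R[ε] = record { isCommutativeRing = isCommutativeRingε }

  infixl 7 _:+ε_ _:-ε_
  infixl 8 _:*ε_
  _:+ε_ _:-ε_ _:*ε_ : ∀ {n} → Polynomial n × Polynomial n → Polynomial n × Polynomial n → Polynomial n × Polynomial n
  (a , b) :+ε (a′ , b′) = (a :+ a′ , b :+ b′)
  (a , b) :-ε (a′ , b′) = (a :+ :- a′ , b :+ :- b′)
  (a , b) :*ε (a′ , b′) = (a :* a′ , a :* b′ :+ b :* a′)

  module ε = RingBasics R[ε]
  open RingBasics R using (ι; rising; ∑<; NaturalsCancellative)
  open import Relation.Binary.Reasoning.Setoid setoid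

  ι-ε : ∀ k → ε.ι k ≈ε (ι k , 0#)
  ι-ε zero    = refl , refl
  ι-ε (suc k) = +-congˡ (proj₁ (ι-ε k)) , trans (+-congˡ (proj₂ (ι-ε k))) (+-identityʳ 0#)

  ∑<-ε : ∀ (f : ℕ → Carrier × Carrier) m → ε.∑< f m ≈ε (∑< (λ k → proj₁ (f k)) m , ∑< (λ k → proj₂ (f k)) m)
  ∑<-ε f zero    = refl , refl
  ∑<-ε f (suc m) = +-congʳ (proj₁ (∑<-ε f m)) , +-congʳ (proj₂ (∑<-ε f m))

  ∂rising : Carrier → ℕ → Carrier
  ∂rising u zero    = 0#
  ∂rising u (suc m) = ∂rising u m * (u + ι m) + rising u m

  rising-ε : ∀ u u′ m → ε.rising (u , u′) m ≈ε (rising u m , u′ * ∂rising u m)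
  rising-ε u u′ zero    = refl , sym (zeroʳ u′)
  rising-ε u u′ (suc m) =
    *-cong r₁ (+-congˡ ι₁) ,
    trans (+-cong (*-cong r₁ (+-congˡ ι₂)) (*-cong r₂ (+-congˡ ι₁)))
          (solve 4 (λ r u′ d w → r :* (u′ :+ con (+ 0)) :+ (u′ :* d) :* w := u′ :* (d :* w :+ r)) refl
                   (rising u m) u′ (∂rising u m) (u + ι m))
    where
    r₁ : proj₁ (ε.rising (u , u′) m) ≈ rising u m
    r₁ = proj₁ (rising-ε u u′ m)
    r₂ : proj₂ (ε.rising (u , u′) m) ≈ u′ * ∂rising u m
    r₂ = proj₂ (rising-ε u u′ m)
    ι₁ : proj₁ (ε.ι m) ≈ ι m
    ι₁ = proj₁ (ι-ε m)
    ι₂ : proj₂ (ε.ι m) ≈ 0#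
    ι₂ = proj₂ (ι-ε m)

  naturalsCancellative-ε : NaturalsCancellative → ε.NaturalsCancellative
  naturalsCancellative-ε cancel m {y , y′} [1+m]y≈0 =
    cancel m (proj₁ componentwise) ,
    cancel m (trans (sym (trans (+-congˡ (zeroˡ y)) (+-identityʳ _))) (proj₂ componentwise))
    where
    componentwise : (ι (suc m) , 0#) *ε (y , y′) ≈ε (0# , 0#)
    componentwise = CommutativeRing.trans R[ε] (CommutativeRing.*-congʳ R[ε] (CommutativeRing.sym R[ε] (ι-ε (suc m)))) [1+m]y≈0

module TerminatingSums {r ℓ} (R : CommutativeRing r ℓ) (cancel : RingBasics.NaturalsCancellative R)
  (p c : CommutativeRing.Carrier R) where

  open CommutativeRing R
  open RingBasics R

  open ℤ-RingSolver R
  open import Algebra.Properties.Ring ring using (x∙y⁻¹≈ε⇒x≈y)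
  open import Relation.Binary.Reasoning.Setoid setoid

  two a b : Carrier
  two = 1# + 1#
  a   = c - two * p
  b   = two * c - two * p - 1#

  sgn : ℕ → Carrier
  sgn zero    = 1#
  sgn (suc k) = - sgn k

  term : ℕ → ℕ → ℕ → Carrier
  term e n k = sgn k * ι (n C k) * rising a k * rising b k
               * rising (c + ι k) (n ∸ k) * rising (b + ι n + ι k + ι e) (n ∸ k)

  term-vanishes : ∀ e n → term e n (suc n) ≈ 0#
  term-vanishes e n = begin
    term e n (suc n)
      ≈⟨ *-congʳ (*-congʳ (*-congʳ (*-congʳ (*-congˡ (reflexive (≡.cong ι (k>n⇒nCk≡0 (ℕ.n<1+n n)))))))) ⟩
    sgn (suc n) * 0# * _ * _ * _ * _
      ≈⟨ solve 5 (λ s u v w z → s :* con (+ 0) :* u :* v :* w :* z := con (+ 0)) refl _ _ _ _ _ ⟩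
    0# ∎

  ι-pascal : ∀ n k → ι (suc n C k) ≈ ι (n C k) + ι (n C⁻ k)
  ι-pascal n k = trans (reflexive (≡.cong ι ([1+n]Ck≡nCk+nC⁻k n k))) (ι-homo-+ (n C k) (n C⁻ k))

  ι-absorption : ∀ n k → ι k * ι (n C k) + ι k * ι (n C⁻ k) ≈ (1# + ι n) * ι (n C⁻ k)
  ι-absorption n k = begin
    ι k * ι (n C k) + ι k * ι (n C⁻ k)      ≈⟨ +-cong (ι-homo-* k (n C k)) (ι-homo-* k (n C⁻ k)) ⟨
    ι (k ℕ.* (n C k)) + ι (k ℕ.* (n C⁻ k))    ≈⟨ ι-homo-+ (k ℕ.* (n C k)) (k ℕ.* (n C⁻ k)) ⟨
    ι (k ℕ.* (n C k) ℕ.+ k ℕ.* (n C⁻ k))      ≡⟨ ≡.cong ι (k*nCk+k*nC⁻k≡[1+n]*nC⁻k n k) ⟩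
    ι (suc n ℕ.* (n C⁻ k))                    ≈⟨ ι-homo-* (suc n) (n C⁻ k) ⟩
    (1# + ι n) * ι (n C⁻ k)                 ∎

  ι-nCn : ∀ n → ι (n C n) ≈ 1#
  ι-nCn n = trans (reflexive (≡.cong ι (nCn≡1 n))) (+-identityʳ 1#)

  ι-nC⁻n : ∀ n → ι (n C⁻ n) ≈ ι n
  ι-nC⁻n n = begin
    ι (n C⁻ n)                                  ≈⟨ solve 2 (λ N C⁻ → C⁻ := (con (+ 1) :+ N) :* C⁻ :- N :* C⁻) refl (ι n) _ ⟩
    (1# + ι n) * ι (n C⁻ n) - ι n * ι (n C⁻ n)  ≈⟨ +-congʳ (ι-absorption n n) ⟨
    (ι n * ι (n C n) + ι n * ι (n C⁻ n)) - ι n * ι (n C⁻ n) ≈⟨ +-congʳ (+-congʳ (*-congˡ (ι-nCn n))) ⟩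
    (ι n * 1# + ι n * ι (n C⁻ n)) - ι n * ι (n C⁻ n) ≈⟨ solve 2 (λ N C⁻ → (N :* con (+ 1) :+ N :* C⁻) :- N :* C⁻ := N) refl (ι n) _ ⟩
    ι n                                         ∎

  rising-suc′ : ∀ u v m → v ≈ u + 1# → rising u (suc m) ≈ u * rising v m
  rising-suc′ u v m v≈u+1 = trans (rising-suc u m) (*-congˡ (rising-cong m (sym v≈u+1)))

  ρ₁ : ℕ → Carrier
  ρ₁ n = two * (two * p + 1# + two * ι n) * (c - p + ι n)

  -- A Zeilberger certificate for the recurrence satisfied by ∑ₖ term 1 n k.
  certificate₁ : ℕ → ℕ → Carrier
  certificate₁ n k = sgn k * ι (n C⁻ k) * rising a k * rising b k
                     * rising (c + ι k - 1#) (suc (n ∸ k)) * rising (b + ι n + 1# + ι k) (n ∸ k)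

  scale₁ : ℕ → Carrier
  scale₁ n = - (two * (c - p + ι n))

  defect₁ : ℕ → ℕ → Carrier
  defect₁ n k = term 1 (suc n) k - ρ₁ n * term 1 n k

  module Step₁ (k m : ℕ) where
    n : ℕ
    n = suc (k ℕ.+ m)

    S Ck Ck⁻ A B K M L N Cc β Rβ : Carrier
    S   = sgn k
    Ck  = ι (n C k)
    Ck⁻ = ι (n C⁻ k)
    A   = rising a k
    B   = rising b k
    K   = ι k
    M   = ι m
    L   = ι (k ℕ.+ m)
    N   = ι n
    Cc  = rising (c + K) m
    β   = b + N + 1# + ι (suc k)
    Rβ  = rising β m

    K+M≈L : K + M ≈ L
    K+M≈L = sym (ι-homo-+ k m)

    +M : ∀ w u → w ≈ u + K → w + M ≈ u + L
    +M w u w≈u+K = trans (+-congʳ w≈u+K) (trans (+-assoc u K M) (+-congˡ K+M≈L))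

    +[1+M] : ∀ w u → w ≈ u + K → w + (1# + M) ≈ u + (1# + L)
    +[1+M] w u w≈u+K = begin
      w + (1# + M)        ≈⟨ +-congʳ w≈u+K ⟩
      (u + K) + (1# + M)  ≈⟨ solve 3 (λ u K M → (u :+ K) :+ (con (+ 1) :+ M) := (u :+ con (+ 1)) :+ (K :+ M)) refl u K M ⟩
      (u + 1#) + (K + M)  ≈⟨ +-congˡ K+M≈L ⟩
      (u + 1#) + L        ≈⟨ +-assoc u 1# L ⟩
      u + (1# + L)        ∎

    n∸k≡1+m : n ∸ k ≡ suc m
    n∸k≡1+m = ≡.trans (≡.cong (_∸ k) (≡.sym (ℕ.+-suc k m))) (ℕ.m+n∸m≡n k (suc m))

    [1+n]∸k≡2+m : suc n ∸ k ≡ suc (suc m)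
    [1+n]∸k≡2+m = ≡.trans (≡.cong (λ z → suc z ∸ k) (≡.sym (ℕ.+-suc k m)))
                    (≡.trans (≡.cong (_∸ k) (≡.sym (ℕ.+-suc k (suc m)))) (ℕ.m+n∸m≡n k (suc (suc m))))

    n∸[1+k]≡m : n ∸ suc k ≡ m
    n∸[1+k]≡m = ℕ.m+n∸m≡n k m

    term-n : term 1 n k ≈ S * Ck * A * B * (Cc * (c + L)) * ((b + N + K + (1# + 0#)) * Rβ)
    term-n = *-cong (*-congˡ c-part) b-part
      where
      c-part : rising (c + K) (n ∸ k) ≈ Cc * (c + L)
      c-part = trans (rising-≡ (c + K) n∸k≡1+m) (*-congˡ (+M (c + K) c refl))
      b-part : rising (b + N + K + (1# + 0#)) (n ∸ k) ≈ (b + N + K + (1# + 0#)) * Rβ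
      b-part = trans (rising-≡ _ n∸k≡1+m) (rising-suc′ _ β m
        (solve 3 (λ b N K → b :+ N :+ con (+ 1) :+ (con (+ 1) :+ K) := (b :+ N :+ K :+ (con (+ 1) :+ con (+ 0))) :+ con (+ 1)) refl b N K))

    γ : Carrier
    γ = b + (1# + N) + (1# + 0#)

    term-1+n : term 1 (suc n) k ≈ S * (Ck + Ck⁻) * A * B * (Cc * (c + L) * (c + (1# + L))) * (Rβ * (γ + L) * (γ + (1# + L)))
    term-1+n = *-cong (*-cong (*-congʳ (*-congʳ (*-congˡ (ι-pascal n k)))) c-part) b-part
      where
      c-part : rising (c + K) (suc n ∸ k) ≈ Cc * (c + L) * (c + (1# + L))
      c-part = trans (rising-≡ (c + K) [1+n]∸k≡2+m) (*-cong (*-congˡ (+M (c + K) c refl)) (+[1+M] (c + K) c refl))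
      V : Carrier
      V = b + ι (suc n) + K + ι 1
      V≈β : V ≈ β
      V≈β = solve 3 (λ b N K → b :+ (con (+ 1) :+ N) :+ K :+ (con (+ 1) :+ con (+ 0)) := b :+ N :+ con (+ 1) :+ (con (+ 1) :+ K)) refl b N K
      V≈γ+K : V ≈ γ + K
      V≈γ+K = solve 3 (λ b N K → b :+ (con (+ 1) :+ N) :+ K :+ (con (+ 1) :+ con (+ 0)) := b :+ (con (+ 1) :+ N) :+ (con (+ 1) :+ con (+ 0)) :+ K) refl b N K
      b-part : rising V (suc n ∸ k) ≈ Rβ * (γ + L) * (γ + (1# + L))
      b-part = trans (rising-≡ V [1+n]∸k≡2+m) (*-cong (*-cong (rising-cong m V≈β) (+M V γ V≈γ+K)) (+[1+M] V γ V≈γ+K))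

    certificate-1+k : certificate₁ n (suc k) ≈ (- S) * Ck * (A * (a + K)) * (B * (b + K)) * (Cc * (c + L)) * Rβ
    certificate-1+k = *-cong (*-congˡ c-part) (rising-≡ β n∸[1+k]≡m)
      where
      c+K≈ : c + ι (suc k) - 1# ≈ c + K
      c+K≈ = solve 2 (λ c K → c :+ (con (+ 1) :+ K) :- con (+ 1) := c :+ K) refl c K
      c-part : rising (c + ι (suc k) - 1#) (suc (n ∸ suc k)) ≈ Cc * (c + L)
      c-part = trans (rising-≡ _ (≡.cong suc n∸[1+k]≡m)) (*-cong (rising-cong m c+K≈) (+M _ c c+K≈))

    certificate-k : certificate₁ n k ≈ S * Ck⁻ * A * B * ((c + K - 1#) * (Cc * (c + L))) * ((b + N + 1# + K) * Rβ)
    certificate-k = *-cong (*-congˡ c-part) b-part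
      where
      c-part : rising (c + K - 1#) (suc (n ∸ k)) ≈ (c + K - 1#) * (Cc * (c + L))
      c-part = trans (rising-≡ _ (≡.cong suc n∸k≡1+m))
               (trans (rising-suc′ _ (c + K) (suc m) (solve 2 (λ c K → c :+ K := (c :+ K :- con (+ 1)) :+ con (+ 1)) refl c K))
                 (*-congˡ (*-congˡ (+M (c + K) c refl))))
      b-part : rising (b + N + 1# + K) (n ∸ k) ≈ (b + N + 1# + K) * Rβ
      b-part = trans (rising-≡ _ n∸k≡1+m)
        (rising-suc′ _ β m (solve 3 (λ b N K → b :+ N :+ con (+ 1) :+ (con (+ 1) :+ K) := (b :+ N :+ con (+ 1) :+ K) :+ con (+ 1)) refl b N K))

    two+L-K≈ι[2+m] : two + L - K ≈ ι (suc (suc m))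
    two+L-K≈ι[2+m] = begin
      two + L - K       ≈⟨ +-congʳ (+-congˡ (sym K+M≈L)) ⟩
      two + (K + M) - K ≈⟨ solve 2 (λ K M → con (+ 2) :+ (K :+ M) :- K := con (+ 1) :+ (con (+ 1) :+ M)) refl K M ⟩
      ι (suc (suc m))   ∎

    -- After clearing the factor n + 1 - k, the step is a polynomial identity modulo
    -- k·C(n,k) + k·C(n,k-1) = (n+1)·C(n,k-1).
    defect₁-telescopes : defect₁ n k ≈ scale₁ n * (certificate₁ n (suc k) - certificate₁ n k)
    defect₁-telescopes = x∙y⁻¹≈ε⇒x≈y _ _ (cancel (suc m) (begin
      ι (suc (suc m)) * (defect₁ n k - scale₁ n * (certificate₁ n (suc k) - certificate₁ n k))
        ≈⟨ *-cong (sym two+L-K≈ι[2+m]) (+-cong (+-cong term-1+n (-‿cong (*-congˡ term-n)))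
                                                (-‿cong (*-congˡ (+-cong certificate-1+k (-‿cong certificate-k))))) ⟩
      _ ≈⟨ solve 11 (λ S Ck Ck⁻ A B Cc Rβ K L p c →
             let one = con (+ 1) ; tw = con (+ 2) in
             let a = c :- tw :* p ; b = tw :* c :- tw :* p :- one in
             let N = one :+ L in
             let γ = b :+ (one :+ N) :+ (one :+ con (+ 0)) in
             let T₁ = S :* (Ck :+ Ck⁻) :* A :* B :* (Cc :* (c :+ L) :* (c :+ (one :+ L))) :* (Rβ :* (γ :+ L) :* (γ :+ (one :+ L))) in
             let T₀ = S :* Ck :* A :* B :* (Cc :* (c :+ L)) :* ((b :+ N :+ K :+ (one :+ con (+ 0))) :* Rβ) in
             let G₁ = (:- S) :* Ck :* (A :* (a :+ K)) :* (B :* (b :+ K)) :* (Cc :* (c :+ L)) :* Rβ in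
             let G₀ = S :* Ck⁻ :* A :* B :* ((c :+ K :- one) :* (Cc :* (c :+ L))) :* ((b :+ N :+ one :+ K) :* Rβ) in
             let ρ = tw :* (tw :* p :+ one :+ tw :* N) :* (c :- p :+ N) in
             let σ₁ = :- (tw :* (c :- p :+ N)) in
             let common = S :* A :* B :* Cc :* (c :+ L) :* Rβ in
             let δ = (c :+ N) :* (b :+ tw :* N :+ one) :* (b :+ tw :* N :+ tw) :+ σ₁ :* (c :+ K :- one) :* (b :+ N :+ one :+ K) in
             (tw :+ L :- K) :* ((T₁ :- ρ :* T₀) :- σ₁ :* (G₁ :- G₀))
               := :- (common :* δ :* (K :* Ck :+ K :* Ck⁻ :- (one :+ N) :* Ck⁻))) refl
             S Ck Ck⁻ A B Cc Rβ K L p c ⟩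
      - (_ * ((K * Ck + K * Ck⁻) - (1# + N) * Ck⁻)) ≈⟨ -‿cong (*-congˡ (+-congʳ (ι-absorption n k))) ⟩
      - (_ * ((1# + N) * Ck⁻ - (1# + N) * Ck⁻))    ≈⟨ -‿cong (*-congˡ (-‿inverseʳ _)) ⟩
      - (_ * 0#)                                  ≈⟨ solve 1 (λ z → :- (z :* con (+ 0)) := con (+ 0)) refl _ ⟩
      0# ∎))

  defect₁-telescopes : ∀ n k → k < n → defect₁ n k ≈ scale₁ n * (certificate₁ n (suc k) - certificate₁ n k)
  defect₁-telescopes n k k<n = ≡.subst (λ n → defect₁ n k ≈ scale₁ n * (certificate₁ n (suc k) - certificate₁ n k))
                                 (ℕ.m+[n∸m]≡n k<n) (Step₁.defect₁-telescopes k (n ∸ suc k))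

  module Top₁ (n : ℕ) where
    S A B N : Carrier
    S = sgn n
    A = rising a n
    B = rising b n
    N = ι n

    certificate-n : certificate₁ n n ≈ S * N * A * B * (c + N - 1#)
    certificate-n = begin
      certificate₁ n n
        ≈⟨ *-cong (*-cong (*-congʳ (*-congʳ (*-congˡ (ι-nC⁻n n)))) (trans (rising-≡ _ (≡.cong suc (ℕ.n∸n≡0 n))) (rising-1 _)))
                  (rising-≡ _ (ℕ.n∸n≡0 n)) ⟩
      S * N * A * B * (c + N - 1#) * 1# ≈⟨ *-identityʳ _ ⟩
      S * N * A * B * (c + N - 1#)      ∎

    term-1+n-n : term 1 (suc n) n ≈ S * (1# + N) * A * B * (c + N) * (b + (1# + N) + N + (1# + 0#))
    term-1+n-n = *-cong (*-cong (*-congʳ (*-congʳ (*-congˡ (trans (ι-pascal n n) (+-cong (ι-nCn n) (ι-nC⁻n n))))))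
                                (trans (rising-≡ _ (ℕ.m+n∸n≡m 1 n)) (rising-1 _)))
                        (trans (rising-≡ _ (ℕ.m+n∸n≡m 1 n)) (rising-1 _))

    term-n-n : term 1 n n ≈ S * A * B
    term-n-n = begin
      term 1 n n ≈⟨ *-cong (*-cong (*-congʳ (*-congʳ (*-congˡ (ι-nCn n)))) (rising-≡ _ (ℕ.n∸n≡0 n))) (rising-≡ _ (ℕ.n∸n≡0 n)) ⟩
      S * 1# * A * B * 1# * 1# ≈⟨ solve 3 (λ S A B → S :* con (+ 1) :* A :* B :* con (+ 1) :* con (+ 1) := S :* A :* B) refl S A B ⟩
      S * A * B ∎

    term-1+n-1+n : term 1 (suc n) (suc n) ≈ (- S) * (A * (a + N)) * (B * (b + N))
    term-1+n-1+n = begin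
      term 1 (suc n) (suc n)
        ≈⟨ *-cong (*-cong (*-congʳ (*-congʳ (*-congˡ (ι-nCn (suc n))))) (rising-≡ _ (ℕ.n∸n≡0 n))) (rising-≡ _ (ℕ.n∸n≡0 n)) ⟩
      (- S) * 1# * (A * (a + N)) * (B * (b + N)) * 1# * 1#
        ≈⟨ solve 3 (λ S X Y → S :* con (+ 1) :* X :* Y :* con (+ 1) :* con (+ 1) := S :* X :* Y) refl (- S) _ _ ⟩
      (- S) * (A * (a + N)) * (B * (b + N)) ∎

    defect₁-top : scale₁ n * certificate₁ n n + (defect₁ n n + defect₁ n (suc n)) ≈ 0#
    defect₁-top = begin
      scale₁ n * certificate₁ n n + (defect₁ n n + defect₁ n (suc n))
        ≈⟨ +-cong (*-congˡ certificate-n) (+-cong (+-cong term-1+n-n (-‿cong (*-congˡ term-n-n)))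
                                                   (+-cong term-1+n-1+n (-‿cong (*-congˡ (term-vanishes 1 n))))) ⟩
      _ ≈⟨ solve 6 (λ S A B N p c →
             let one = con (+ 1) ; tw = con (+ 2) in
             let a = c :- tw :* p ; b = tw :* c :- tw :* p :- one in
             let ρ = tw :* (tw :* p :+ one :+ tw :* N) :* (c :- p :+ N) in
             let σ₁ = :- (tw :* (c :- p :+ N)) in
             σ₁ :* (S :* N :* A :* B :* (c :+ N :- one))
               :+ ((S :* (one :+ N) :* A :* B :* (c :+ N) :* (b :+ (one :+ N) :+ N :+ (one :+ con (+ 0))) :- ρ :* (S :* A :* B))
               :+ ((:- S) :* (A :* (a :+ N)) :* (B :* (b :+ N)) :- ρ :* con (+ 0)))
             := con (+ 0)) refl S A B N p c ⟩
      0# ∎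

  ∑<-defect₁ : ∀ n → ∑< (defect₁ n) (suc (suc n)) ≈ 0#
  ∑<-defect₁ n = begin
    (∑< (defect₁ n) n + defect₁ n n) + defect₁ n (suc n)    ≈⟨ +-assoc _ _ _ ⟩
    ∑< (defect₁ n) n + (defect₁ n n + defect₁ n (suc n))    ≈⟨ +-congʳ telescope ⟩
    (scale₁ n * certificate₁ n n - scale₁ n * certificate₁ n 0) + (defect₁ n n + defect₁ n (suc n))
      ≈⟨ +-congʳ (+-congˡ (-‿cong (*-congˡ certificate-0))) ⟩
    (scale₁ n * certificate₁ n n - scale₁ n * 0#) + (defect₁ n n + defect₁ n (suc n))
      ≈⟨ +-congʳ (solve 2 (λ u v → u :- v :* con (+ 0) := u) refl _ (scale₁ n)) ⟩
    scale₁ n * certificate₁ n n + (defect₁ n n + defect₁ n (suc n)) ≈⟨ Top₁.defect₁-top n ⟩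
    0# ∎
    where
    telescope : ∑< (defect₁ n) n ≈ scale₁ n * certificate₁ n n - scale₁ n * certificate₁ n 0
    telescope = ∑<-telescope (defect₁ n) (λ k → scale₁ n * certificate₁ n k) n
      (λ k k<n → trans (defect₁-telescopes n k k<n) (solve 3 (λ x u v → x :* (u :- v) := x :* u :- x :* v) refl (scale₁ n) _ _))
    certificate-0 : certificate₁ n 0 ≈ 0#
    certificate-0 = solve 4 (λ u v w z → con (+ 1) :* con (+ 0) :* u :* v :* w :* z := con (+ 0)) refl _ _ _ _

  ∑<-term₁ : ∀ n → ∑< (term 1 n) (suc n) ≈ ∏< ρ₁ n
  ∑<-term₁ zero    = solve 0 (con (+ 0) :+ con (+ 1) :* (con (+ 1) :+ con (+ 0)) :* con (+ 1) :* con (+ 1) :* con (+ 1) :* con (+ 1) := con (+ 1)) refl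
  ∑<-term₁ (suc n) = begin
    ∑< (term 1 (suc n)) (suc (suc n)) ≈⟨ ∑<-first-order (term 1) (ρ₁ n) n (term-vanishes 1 n) (∑<-defect₁ n) ⟩
    ρ₁ n * ∑< (term 1 n) (suc n)      ≈⟨ *-congˡ (∑<-term₁ n) ⟩
    ρ₁ n * ∏< ρ₁ n                  ≈⟨ *-comm _ _ ⟩
    ∏< ρ₁ (suc n)                  ∎

  term₂ : ℕ → ℕ → Carrier
  term₂ n k = two * term 0 n k - term 1 n k

  ρ₂ : ℕ → Carrier
  ρ₂ n = two * (p + ι n) * (b + two * ι n)

  scale₂ : ℕ → ℕ → Carrier
  scale₂ n k = - (two * (b + two * ι n) * (c - p - 1# + ι k))

  certificate₂ : ℕ → ℕ → Carrier
  certificate₂ n k = scale₂ n k * (sgn k * ι (n C⁻ k) * rising a k * rising b k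
                       * rising (c + ι k - 1#) (suc (n ∸ k)) * rising (b + ι n + 1# + ι k) (n ∸ suc k))

  defect₂ : ℕ → ℕ → Carrier
  defect₂ n k = term₂ (suc n) k - ρ₂ n * term₂ n k

  module Step₂ (k m : ℕ) where
    n : ℕ
    n = suc (suc (k ℕ.+ m))

    S Ck Ck⁻ A B K M L N Cc β Rβ δ c₂ : Carrier
    S   = sgn k
    Ck  = ι (n C k)
    Ck⁻ = ι (n C⁻ k)
    A   = rising a k
    B   = rising b k
    K   = ι k
    M   = ι m
    L   = ι (k ℕ.+ m)
    N   = ι n
    Cc  = rising (c + K) m
    β   = b + N + 1# + ι (suc k)
    Rβ  = rising β m
    δ   = b + N + 1# + 1#
    c₂  = Cc * (c + L) * (c + (1# + L))

    open Step₁ k m using (K+M≈L; +M; +[1+M])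

    +[2+M] : ∀ w u → w ≈ u + K → w + (1# + (1# + M)) ≈ u + (1# + (1# + L))
    +[2+M] w u w≈u+K = begin
      w + (1# + (1# + M))   ≈⟨ solve 2 (λ w M → w :+ (con (+ 1) :+ (con (+ 1) :+ M)) := (w :+ con (+ 1)) :+ (con (+ 1) :+ M)) refl w M ⟩
      (w + 1#) + (1# + M)   ≈⟨ +[1+M] (w + 1#) (u + 1#) (trans (+-congʳ w≈u+K) (solve 2 (λ u K → u :+ K :+ con (+ 1) := u :+ con (+ 1) :+ K) refl u K)) ⟩
      (u + 1#) + (1# + L)   ≈⟨ solve 2 (λ u L → (u :+ con (+ 1)) :+ (con (+ 1) :+ L) := u :+ (con (+ 1) :+ (con (+ 1) :+ L))) refl u L ⟩
      u + (1# + (1# + L))   ∎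

    k+[1+j]≡1+[k+j] : ∀ j → suc (k ℕ.+ j) ≡ k ℕ.+ suc j
    k+[1+j]≡1+[k+j] j = ≡.sym (ℕ.+-suc k j)

    n∸k≡2+m : n ∸ k ≡ suc (suc m)
    n∸k≡2+m = ≡.trans (≡.cong (λ z → suc z ∸ k) (k+[1+j]≡1+[k+j] m))
                (≡.trans (≡.cong (_∸ k) (k+[1+j]≡1+[k+j] (suc m))) (ℕ.m+n∸m≡n k (suc (suc m))))

    [1+n]∸k≡3+m : suc n ∸ k ≡ suc (suc (suc m))
    [1+n]∸k≡3+m = ≡.trans (≡.cong (λ z → suc (suc z) ∸ k) (k+[1+j]≡1+[k+j] m))
                    (≡.trans (≡.cong (λ z → suc z ∸ k) (k+[1+j]≡1+[k+j] (suc m)))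
                      (≡.trans (≡.cong (_∸ k) (k+[1+j]≡1+[k+j] (suc (suc m)))) (ℕ.m+n∸m≡n k (suc (suc (suc m))))))

    n∸[1+k]≡1+m : n ∸ suc k ≡ suc m
    n∸[1+k]≡1+m = ≡.trans (≡.cong (_∸ k) (k+[1+j]≡1+[k+j] m)) (ℕ.m+n∸m≡n k (suc m))

    n∸[2+k]≡m : n ∸ suc (suc k) ≡ m
    n∸[2+k]≡m = ℕ.m+n∸m≡n k m

    β≈δ+K : β ≈ δ + K
    β≈δ+K = solve 3 (λ b N K → b :+ N :+ con (+ 1) :+ (con (+ 1) :+ K) := b :+ N :+ con (+ 1) :+ con (+ 1) :+ K) refl b N K

    rising-2+m : ∀ w → w ≈ c + K → rising w (suc (suc m)) ≈ c₂
    rising-2+m w w≈c+K = *-cong (*-cong (rising-cong m w≈c+K) (+M w c w≈c+K)) (+[1+M] w c w≈c+K)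

    rising-3+m : rising (c + K) (suc (suc (suc m))) ≈ c₂ * (c + (1# + (1# + L)))
    rising-3+m = *-cong (rising-2+m (c + K) refl) (+[2+M] (c + K) c refl)

    U₀ U₁ U₀′ γ : Carrier
    U₀  = b + N + K + 0#
    U₁  = b + N + K + (1# + 0#)
    U₀′ = b + (1# + N) + K + 0#
    γ   = b + (1# + N) + (1# + 0#)

    term₀-n : term 0 n k ≈ S * Ck * A * B * c₂ * (U₀ * ((U₀ + 1#) * Rβ))
    term₀-n = *-cong (*-congˡ (trans (rising-≡ _ n∸k≡2+m) (rising-2+m (c + K) refl)))
                (trans (rising-≡ _ n∸k≡2+m) (trans (rising-suc′ U₀ (U₀ + 1#) (suc m) refl)
                  (*-congˡ (rising-suc′ (U₀ + 1#) β m
                    (solve 3 (λ b N K → b :+ N :+ con (+ 1) :+ (con (+ 1) :+ K) := (b :+ N :+ K :+ con (+ 0)) :+ con (+ 1) :+ con (+ 1)) refl b N K)))))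

    term₁-n : term 1 n k ≈ S * Ck * A * B * c₂ * (U₁ * (Rβ * (δ + L)))
    term₁-n = *-cong (*-congˡ (trans (rising-≡ _ n∸k≡2+m) (rising-2+m (c + K) refl)))
                (trans (rising-≡ _ n∸k≡2+m) (trans (rising-suc′ U₁ β (suc m)
                  (solve 3 (λ b N K → b :+ N :+ con (+ 1) :+ (con (+ 1) :+ K) := (b :+ N :+ K :+ (con (+ 1) :+ con (+ 0))) :+ con (+ 1)) refl b N K))
                  (*-congˡ (*-congˡ (+M β δ β≈δ+K)))))

    term₀-1+n : term 0 (suc n) k ≈ S * (Ck + Ck⁻) * A * B * (c₂ * (c + (1# + (1# + L)))) * (U₀′ * (Rβ * (δ + L) * (δ + (1# + L))))
    term₀-1+n = *-cong (*-cong (*-congʳ (*-congʳ (*-congˡ (ι-pascal n k)))) (trans (rising-≡ _ [1+n]∸k≡3+m) rising-3+m))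
                  (trans (rising-≡ _ [1+n]∸k≡3+m) (trans (rising-suc′ U₀′ β (suc (suc m))
                    (solve 3 (λ b N K → b :+ N :+ con (+ 1) :+ (con (+ 1) :+ K) := (b :+ (con (+ 1) :+ N) :+ K :+ con (+ 0)) :+ con (+ 1)) refl b N K))
                    (*-congˡ (*-cong (*-congˡ (+M β δ β≈δ+K)) (+[1+M] β δ β≈δ+K)))))

    term₁-1+n : term 1 (suc n) k ≈ S * (Ck + Ck⁻) * A * B * (c₂ * (c + (1# + (1# + L)))) * (Rβ * (γ + L) * (γ + (1# + L)) * (γ + (1# + (1# + L))))
    term₁-1+n = *-cong (*-cong (*-congʳ (*-congʳ (*-congˡ (ι-pascal n k)))) (trans (rising-≡ _ [1+n]∸k≡3+m) rising-3+m))
                  (trans (rising-≡ _ [1+n]∸k≡3+m) (*-cong (*-cong (*-cong (rising-cong m V≈β) (+M V γ V≈γ+K)) (+[1+M] V γ V≈γ+K)) (+[2+M] V γ V≈γ+K)))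
      where
      V : Carrier
      V = b + (1# + N) + K + (1# + 0#)
      V≈β : V ≈ β
      V≈β = solve 3 (λ b N K → b :+ (con (+ 1) :+ N) :+ K :+ (con (+ 1) :+ con (+ 0)) := b :+ N :+ con (+ 1) :+ (con (+ 1) :+ K)) refl b N K
      V≈γ+K : V ≈ γ + K
      V≈γ+K = solve 3 (λ b N K → b :+ (con (+ 1) :+ N) :+ K :+ (con (+ 1) :+ con (+ 0)) := b :+ (con (+ 1) :+ N) :+ (con (+ 1) :+ con (+ 0)) :+ K) refl b N K

    certificate-1+k : certificate₂ n (suc k) ≈ scale₂ n (suc k) * ((- S) * Ck * (A * (a + K)) * (B * (b + K)) * c₂ * Rβ)
    certificate-1+k = *-congˡ (*-cong (*-congˡ (trans (rising-≡ _ (≡.cong suc n∸[1+k]≡1+m))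
                        (rising-2+m _ (solve 2 (λ c K → c :+ (con (+ 1) :+ K) :- con (+ 1) := c :+ K) refl c K))))
                      (rising-≡ β n∸[2+k]≡m))

    certificate-k : certificate₂ n k ≈ scale₂ n k * (S * Ck⁻ * A * B * ((c + K - 1#) * c₂) * ((b + N + 1# + K) * Rβ))
    certificate-k = *-congˡ (*-cong (*-congˡ c-part) b-part)
      where
      c-part : rising (c + K - 1#) (suc (n ∸ k)) ≈ (c + K - 1#) * c₂
      c-part = trans (rising-≡ _ (≡.cong suc n∸k≡2+m))
                 (trans (rising-suc′ _ (c + K) (suc (suc m)) (solve 2 (λ c K → c :+ K := (c :+ K :- con (+ 1)) :+ con (+ 1)) refl c K))
                   (*-congˡ (rising-2+m (c + K) refl)))
      b-part : rising (b + N + 1# + K) (n ∸ suc k) ≈ (b + N + 1# + K) * Rβ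
      b-part = trans (rising-≡ _ n∸[1+k]≡1+m)
        (rising-suc′ _ β m (solve 3 (λ b N K → b :+ N :+ con (+ 1) :+ (con (+ 1) :+ K) := (b :+ N :+ con (+ 1) :+ K) :+ con (+ 1)) refl b N K))

    three+L-K≈ι[3+m] : 1# + (1# + (1# + L)) - K ≈ ι (suc (suc (suc m)))
    three+L-K≈ι[3+m] = begin
      1# + (1# + (1# + L)) - K       ≈⟨ +-congʳ (+-congˡ (+-congˡ (+-congˡ (sym K+M≈L)))) ⟩
      1# + (1# + (1# + (K + M))) - K ≈⟨ solve 2 (λ K M → con (+ 1) :+ (con (+ 1) :+ (con (+ 1) :+ (K :+ M))) :- K
                                                    := con (+ 1) :+ (con (+ 1) :+ (con (+ 1) :+ M))) refl K M ⟩
      ι (suc (suc (suc m)))          ∎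

    -- As for defect₁, after clearing the factor n + 1 - k.
    defect₂-telescopes : defect₂ n k ≈ certificate₂ n (suc k) - certificate₂ n k
    defect₂-telescopes = x∙y⁻¹≈ε⇒x≈y _ _ (cancel (suc (suc m)) (begin
      ι (suc (suc (suc m))) * (defect₂ n k - (certificate₂ n (suc k) - certificate₂ n k))
        ≈⟨ *-cong (sym three+L-K≈ι[3+m])
                  (+-cong (+-cong (+-cong (*-congˡ term₀-1+n) (-‿cong term₁-1+n)) (-‿cong (*-congˡ (+-cong (*-congˡ term₀-n) (-‿cong term₁-n)))))
                          (-‿cong (+-cong certificate-1+k (-‿cong certificate-k)))) ⟩
      _ ≈⟨ solve 11 (λ Ck Ck⁻ S A B Cc Rβ K L p c →
             let one = con (+ 1) ; tw = con (+ 2) ; zr = con (+ 0) in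
             let E = λ Ck Ck⁻ →
                   let N = one :+ (one :+ L) in
                   let a = c :- tw :* p ; b = tw :* c :- tw :* p :- one in
                   let c₂ = Cc :* (c :+ L) :* (c :+ (one :+ L)) in
                   let c₃ = c₂ :* (c :+ (one :+ (one :+ L))) in
                   let U₀ = b :+ N :+ K :+ zr ; U₁ = b :+ N :+ K :+ (one :+ zr) in
                   let δ = b :+ N :+ one :+ one in
                   let U₀′ = b :+ (one :+ N) :+ K :+ zr ; γ = b :+ (one :+ N) :+ (one :+ zr) in
                   let T₀ = S :* Ck :* A :* B :* c₂ :* (U₀ :* ((U₀ :+ one) :* Rβ)) in
                   let T₁ = S :* Ck :* A :* B :* c₂ :* (U₁ :* (Rβ :* (δ :+ L))) in
                   let T₀′ = S :* (Ck :+ Ck⁻) :* A :* B :* c₃ :* (U₀′ :* (Rβ :* (δ :+ L) :* (δ :+ (one :+ L)))) in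
                   let T₁′ = S :* (Ck :+ Ck⁻) :* A :* B :* c₃ :* (Rβ :* (γ :+ L) :* (γ :+ (one :+ L)) :* (γ :+ (one :+ (one :+ L)))) in
                   let σ₁ = :- (tw :* (b :+ tw :* N) :* (c :- p :- one :+ (one :+ K))) in
                   let σ₀ = :- (tw :* (b :+ tw :* N) :* (c :- p :- one :+ K)) in
                   let G₁ = σ₁ :* ((:- S) :* Ck :* (A :* (a :+ K)) :* (B :* (b :+ K)) :* c₂ :* Rβ) in
                   let G₀ = σ₀ :* (S :* Ck⁻ :* A :* B :* ((c :+ K :- one) :* c₂) :* ((b :+ N :+ one :+ K) :* Rβ)) in
                   let ρ = tw :* (p :+ N) :* (b :+ tw :* N) in
                   (tw :* T₀′ :- T₁′) :- ρ :* (tw :* T₀ :- T₁) :- (G₁ :- G₀) in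
             (one :+ (one :+ (one :+ L)) :- K) :* E Ck Ck⁻
               := :- (E zr one :* (K :* Ck :+ K :* Ck⁻ :- (one :+ (one :+ (one :+ L))) :* Ck⁻))) refl
             Ck Ck⁻ S A B Cc Rβ K L p c ⟩
      - (_ * ((K * Ck + K * Ck⁻) - (1# + N) * Ck⁻)) ≈⟨ -‿cong (*-congˡ (+-congʳ (ι-absorption n k))) ⟩
      - (_ * ((1# + N) * Ck⁻ - (1# + N) * Ck⁻))     ≈⟨ -‿cong (*-congˡ (-‿inverseʳ _)) ⟩
      - (_ * 0#)                                     ≈⟨ solve 1 (λ z → :- (z :* con (+ 0)) := con (+ 0)) refl _ ⟩
      0# ∎))

  defect₂-telescopes : ∀ n k → suc k < n → defect₂ n k ≈ certificate₂ n (suc k) - certificate₂ n k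
  defect₂-telescopes n k 1+k<n = ≡.subst (λ n → defect₂ n k ≈ certificate₂ n (suc k) - certificate₂ n k)
                                   (ℕ.m+[n∸m]≡n 1+k<n) (Step₂.defect₂-telescopes k (n ∸ suc (suc k)))

  -- The last three defects, for n = j + 1, are not covered by the certificate.
  module Top₂ (j : ℕ) where
    n : ℕ
    n = suc j

    S A B J N Ck⁻ : Carrier
    S   = sgn j
    A   = rising a j
    B   = rising b j
    J   = ι j
    N   = ι n
    Ck⁻ = ι (n C⁻ j)

    two*Ck⁻ : two * Ck⁻ ≈ J * (1# + J)
    two*Ck⁻ = begin
      two * Ck⁻                         ≈⟨ solve 2 (λ J C → con (+ 2) :* C := (con (+ 1) :+ (con (+ 1) :+ J)) :* C :- J :* C) refl J Ck⁻ ⟩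
      (1# + N) * Ck⁻ - J * Ck⁻          ≈⟨ +-congʳ (ι-absorption n j) ⟨
      (J * ι (n C j) + J * Ck⁻) - J * Ck⁻ ≈⟨ +-congʳ (+-congʳ (*-congˡ (ι-nC⁻n n))) ⟩
      (J * N + J * Ck⁻) - J * Ck⁻       ≈⟨ solve 2 (λ J C → (J :* (con (+ 1) :+ J) :+ J :* C) :- J :* C := J :* (con (+ 1) :+ J)) refl J Ck⁻ ⟩
      J * (1# + J)                      ∎

    n∸j≡1 : n ∸ j ≡ 1
    n∸j≡1 = ℕ.m+n∸n≡m 1 j

    [1+n]∸j≡2 : suc n ∸ j ≡ 2
    [1+n]∸j≡2 = ℕ.m+n∸n≡m 2 j

    certificate-j : certificate₂ n j ≈ scale₂ n j * (S * Ck⁻ * A * B * rising (c + J - 1#) 2 * 1#)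
    certificate-j = *-congˡ (*-cong (*-congˡ (rising-≡ _ (≡.cong suc n∸j≡1))) (rising-≡ _ (ℕ.n∸n≡0 j)))

    term-1+n-j : ∀ e → term e (suc n) j ≈ S * (N + Ck⁻) * A * B * rising (c + J) 2 * rising (b + (1# + N) + J + ι e) 2
    term-1+n-j e = *-cong (*-cong (*-congʳ (*-congʳ (*-congˡ (trans (ι-pascal n j) (+-congʳ (ι-nC⁻n n))))))
                                  (rising-≡ _ [1+n]∸j≡2))
                          (rising-≡ _ [1+n]∸j≡2)

    term-n-j : ∀ e → term e n j ≈ S * N * A * B * rising (c + J) 1 * rising (b + N + J + ι e) 1
    term-n-j e = *-cong (*-cong (*-congʳ (*-congʳ (*-congˡ (ι-nC⁻n n)))) (rising-≡ _ n∸j≡1)) (rising-≡ _ n∸j≡1)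

    term-1+n-n : ∀ e → term e (suc n) n ≈ (- S) * (1# + N) * (A * (a + J)) * (B * (b + J)) * rising (c + N) 1 * rising (b + (1# + N) + N + ι e) 1
    term-1+n-n e = *-cong (*-cong (*-congʳ (*-congʳ (*-congˡ (trans (ι-pascal n n) (+-cong (ι-nCn n) (ι-nC⁻n n))))))
                                  (rising-≡ _ (ℕ.m+n∸n≡m 1 n)))
                          (rising-≡ _ (ℕ.m+n∸n≡m 1 n))

    term-n-n : ∀ e → term e n n ≈ (- S) * 1# * (A * (a + J)) * (B * (b + J)) * 1# * 1#
    term-n-n e = *-cong (*-cong (*-congʳ (*-congʳ (*-congˡ (ι-nCn n)))) (rising-≡ _ (ℕ.n∸n≡0 n))) (rising-≡ _ (ℕ.n∸n≡0 n))

    term-1+n-1+n : ∀ e → term e (suc n) (suc n) ≈ (- (- S)) * 1# * (A * (a + J) * (a + N)) * (B * (b + J) * (b + N)) * 1# * 1#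
    term-1+n-1+n e = *-cong (*-cong (*-congʳ (*-congʳ (*-congˡ (ι-nCn (suc n))))) (rising-≡ _ (ℕ.n∸n≡0 (suc n))))
                            (rising-≡ _ (ℕ.n∸n≡0 (suc n)))

    defect₂-top : certificate₂ n j + (defect₂ n j + (defect₂ n n + defect₂ n (suc n))) ≈ 0#
    defect₂-top = cancel 1 (begin
      ι 2 * (certificate₂ n j + (defect₂ n j + (defect₂ n n + defect₂ n (suc n))))
        ≈⟨ *-cong (solve 0 (con (+ 1) :+ (con (+ 1) :+ con (+ 0)) := con (+ 2)) refl)
             (+-cong certificate-j
               (+-cong (+-cong (+-cong (*-congˡ (term-1+n-j 0)) (-‿cong (term-1+n-j 1)))
                               (-‿cong (*-congˡ (+-cong (*-congˡ (term-n-j 0)) (-‿cong (term-n-j 1))))))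
                 (+-cong (+-cong (+-cong (*-congˡ (term-1+n-n 0)) (-‿cong (term-1+n-n 1)))
                                 (-‿cong (*-congˡ (+-cong (*-congˡ (term-n-n 0)) (-‿cong (term-n-n 1))))))
                         (+-cong (+-cong (*-congˡ (term-1+n-1+n 0)) (-‿cong (term-1+n-1+n 1)))
                                 (-‿cong (*-congˡ (+-cong (*-congˡ (term-vanishes 0 n)) (-‿cong (term-vanishes 1 n))))))))) ⟩
      _ ≈⟨ solve 7 (λ S A B J Ck⁻ p c →
             let one = con (+ 1) ; tw = con (+ 2) ; zr = con (+ 0) in
             let rising₁ = λ u → one :* (u :+ zr) in
             let rising₂ = λ u → one :* (u :+ zr) :* (u :+ (one :+ zr)) in
             let E = λ Ck⁻ →
                   let N = one :+ J in
                   let a = c :- tw :* p ; b = tw :* c :- tw :* p :- one in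
                   let ρ = tw :* (p :+ N) :* (b :+ tw :* N) in
                   let σⱼ = :- (tw :* (b :+ tw :* N) :* (c :- p :- one :+ J)) in
                   let T₂ = λ e → S :* (N :+ Ck⁻) :* A :* B :* rising₂ (c :+ J) :* rising₂ (b :+ (one :+ N) :+ J :+ e) in
                   let T₃ = λ e → S :* N :* A :* B :* rising₁ (c :+ J) :* rising₁ (b :+ N :+ J :+ e) in
                   let T₄ = λ e → (:- S) :* (one :+ N) :* (A :* (a :+ J)) :* (B :* (b :+ J)) :* rising₁ (c :+ N) :* rising₁ (b :+ (one :+ N) :+ N :+ e) in
                   let T₅ = (:- S) :* one :* (A :* (a :+ J)) :* (B :* (b :+ J)) :* one :* one in
                   let T₆ = (:- (:- S)) :* one :* (A :* (a :+ J) :* (a :+ N)) :* (B :* (b :+ J) :* (b :+ N)) :* one :* one in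
                   σⱼ :* (S :* Ck⁻ :* A :* B :* rising₂ (c :+ J :- one) :* one)
                     :+ ((tw :* T₂ zr :- T₂ (one :+ zr)) :- ρ :* (tw :* T₃ zr :- T₃ (one :+ zr))
                     :+ (((tw :* T₄ zr :- T₄ (one :+ zr)) :- ρ :* (tw :* T₅ :- T₅))
                     :+ ((tw :* T₆ :- T₆) :- ρ :* (tw :* zr :- zr)))) in
             tw :* E Ck⁻ := (E one :- E zr) :* (tw :* Ck⁻ :- J :* (one :+ J))) refl
             S A B J Ck⁻ p c ⟩
      _ * (two * Ck⁻ - J * (1# + J))          ≈⟨ *-congˡ (+-congʳ two*Ck⁻) ⟩
      _ * (J * (1# + J) - J * (1# + J))       ≈⟨ *-congˡ (-‿inverseʳ _) ⟩
      _ * 0#                                  ≈⟨ zeroʳ _ ⟩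
      0# ∎)

  ∑<-defect₂ : ∀ n → ∑< (defect₂ n) (suc (suc n)) ≈ 0#
  ∑<-defect₂ zero = solve 2 (λ p c →
    let one = con (+ 1) ; tw = con (+ 2) ; zr = con (+ 0) in
    let a = c :- tw :* p ; b = tw :* c :- tw :* p :- one in
    let ρ = tw :* (p :+ zr) :* (b :+ tw :* zr) in
    let rising₁ = λ u → one :* (u :+ zr) in
    zr :+ ((tw :* (one :* (one :+ zr) :* one :* one :* rising₁ (c :+ zr) :* rising₁ (b :+ (one :+ zr) :+ zr :+ zr))
            :- (one :* (one :+ zr) :* one :* one :* rising₁ (c :+ zr) :* rising₁ (b :+ (one :+ zr) :+ zr :+ (one :+ zr))))
           :- ρ :* (tw :* (one :* (one :+ zr) :* one :* one :* one :* one) :- (one :* (one :+ zr) :* one :* one :* one :* one)))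
    :+ ((tw :* ((:- one) :* (one :+ zr) :* (one :* (a :+ zr)) :* (one :* (b :+ zr)) :* one :* one)
            :- ((:- one) :* (one :+ zr) :* (one :* (a :+ zr)) :* (one :* (b :+ zr)) :* one :* one))
           :- ρ :* (tw :* ((:- one) :* zr :* (one :* (a :+ zr)) :* (one :* (b :+ zr)) :* one :* one)
            :- ((:- one) :* zr :* (one :* (a :+ zr)) :* (one :* (b :+ zr)) :* one :* one)))
    := zr) refl p c
  ∑<-defect₂ (suc j) = begin
    ((∑< (defect₂ n) j + defect₂ n j) + defect₂ n n) + defect₂ n (suc n)
      ≈⟨ solve 4 (λ a b c d → ((a :+ b) :+ c) :+ d := a :+ (b :+ (c :+ d))) refl _ _ _ _ ⟩
    ∑< (defect₂ n) j + (defect₂ n j + (defect₂ n n + defect₂ n (suc n)))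
      ≈⟨ +-congʳ telescope ⟩
    (certificate₂ n j - certificate₂ n 0) + (defect₂ n j + (defect₂ n n + defect₂ n (suc n)))
      ≈⟨ +-congʳ (+-congˡ (-‿cong certificate-0)) ⟩
    (certificate₂ n j - 0#) + (defect₂ n j + (defect₂ n n + defect₂ n (suc n)))
      ≈⟨ +-congʳ (solve 1 (λ u → u :- con (+ 0) := u) refl _) ⟩
    certificate₂ n j + (defect₂ n j + (defect₂ n n + defect₂ n (suc n)))
      ≈⟨ Top₂.defect₂-top j ⟩
    0# ∎
    where
    n : ℕ
    n = suc j
    telescope : ∑< (defect₂ n) j ≈ certificate₂ n j - certificate₂ n 0
    telescope = ∑<-telescope (defect₂ n) (certificate₂ n) j (λ k k<j → defect₂-telescopes n k (s≤s k<j))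
    certificate-0 : certificate₂ n 0 ≈ 0#
    certificate-0 = solve 5 (λ σ₀ u v w z → σ₀ :* (con (+ 1) :* con (+ 0) :* u :* v :* w :* z) := con (+ 0)) refl _ _ _ _ _

  ∑<-term₂ : ∀ n → ∑< (term₂ n) (suc n) ≈ ∏< ρ₂ n
  ∑<-term₂ zero    = solve 0 (con (+ 0) :+ (con (+ 2) :* (con (+ 1) :* (con (+ 1) :+ con (+ 0)) :* con (+ 1) :* con (+ 1) :* con (+ 1) :* con (+ 1))
                             :- con (+ 1) :* (con (+ 1) :+ con (+ 0)) :* con (+ 1) :* con (+ 1) :* con (+ 1) :* con (+ 1)) := con (+ 1)) refl
  ∑<-term₂ (suc n) = begin
    ∑< (term₂ (suc n)) (suc (suc n)) ≈⟨ ∑<-first-order term₂ (ρ₂ n) n term₂-vanishes (∑<-defect₂ n) ⟩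
    ρ₂ n * ∑< (term₂ n) (suc n)      ≈⟨ *-congˡ (∑<-term₂ n) ⟩
    ρ₂ n * ∏< ρ₂ n                 ≈⟨ *-comm _ _ ⟩
    ∏< ρ₂ (suc n)                 ∎
    where
    term₂-vanishes : term₂ n (suc n) ≈ 0#
    term₂-vanishes = trans (+-cong (*-congˡ (term-vanishes 0 n)) (-‿cong (term-vanishes 1 n)))
                           (solve 0 (con (+ 2) :* con (+ 0) :- con (+ 0) := con (+ 0)) refl)

  two*∑<-term₀ : ∀ n → two * ∑< (term 0 n) (suc n) ≈ ∏< ρ₁ n + ∏< ρ₂ n
  two*∑<-term₀ n = begin
    two * ∑< (term 0 n) (suc n)
      ≈⟨ solve 3 (λ t u v → t :* u := (t :* u :+ (:- con (+ 1)) :* v) :+ v) refl two _ _ ⟩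
    (two * ∑< (term 0 n) (suc n) + (- 1#) * ∑< (term 1 n) (suc n)) + ∑< (term 1 n) (suc n)
      ≈⟨ +-cong (sym (∑<-linear two (- 1#) (term 0 n) (term 1 n) (suc n))) (∑<-term₁ n) ⟩
    ∑< (λ k → two * term 0 n k + (- 1#) * term 1 n k) (suc n) + ∏< ρ₁ n
      ≈⟨ +-congʳ (∑<-cong (suc n) (λ k _ → solve 3 (λ t u v → t :* u :+ (:- con (+ 1)) :* v := t :* u :- v) refl two _ _)) ⟩
    ∑< (term₂ n) (suc n) + ∏< ρ₁ n ≈⟨ +-congʳ (∑<-term₂ n) ⟩
    ∏< ρ₂ n + ∏< ρ₁ n            ≈⟨ +-comm _ _ ⟩
    ∏< ρ₁ n + ∏< ρ₂ n            ∎

module FieldFacts {c ℓ} (F : CharZeroField c ℓ) where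
  open CharZeroField F
  open FieldOps F
  open ℤ-RingSolver commRing
  open RingBasics commRing hiding (ι)
  open DualNumbers commRing using (∂rising)
  open import Relation.Binary.Reasoning.Setoid setoid

  1≉0 : ¬ (1# ≈ 0#)
  1≉0 1≈0 = charZero 0 (trans (+-identityʳ 1#) 1≈0)

  nonzero-cancelˡ : ∀ x {y} → ¬ (x ≈ 0#) → x * y ≈ 0# → y ≈ 0#
  nonzero-cancelˡ x {y} x≉0 xy≈0 = begin
    y                ≈⟨ *-identityˡ y ⟨
    1# * y           ≈⟨ *-congʳ (inverseʳ x x≉0) ⟨
    (x * x ⁻¹) * y   ≈⟨ solve 3 (λ x i y → (x :* i) :* y := i :* (x :* y)) refl x (x ⁻¹) y ⟩
    x ⁻¹ * (x * y)   ≈⟨ *-congˡ xy≈0 ⟩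
    x ⁻¹ * 0#        ≈⟨ zeroʳ _ ⟩
    0#               ∎

  naturalsCancellative : NaturalsCancellative
  naturalsCancellative m = nonzero-cancelˡ _ (charZero m)

  *-nonzero : ∀ {u v} → ¬ (u ≈ 0#) → ¬ (v ≈ 0#) → ¬ (u * v ≈ 0#)
  *-nonzero {u} u≉0 v≉0 uv≈0 = v≉0 (nonzero-cancelˡ u u≉0 uv≈0)

  inverse-unique : ∀ u v → ¬ (u ≈ 0#) → u * v ≈ 1# → v ≈ u ⁻¹
  inverse-unique u v u≉0 uv≈1 = begin
    v                ≈⟨ *-identityˡ v ⟨
    1# * v           ≈⟨ *-congʳ (trans (*-comm (u ⁻¹) u) (inverseʳ u u≉0)) ⟨
    (u ⁻¹ * u) * v   ≈⟨ *-assoc _ _ _ ⟩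
    u ⁻¹ * (u * v)   ≈⟨ *-congˡ uv≈1 ⟩
    u ⁻¹ * 1#        ≈⟨ *-identityʳ _ ⟩
    u ⁻¹             ∎

  ⁻¹-distrib-* : ∀ u v → ¬ (u ≈ 0#) → ¬ (v ≈ 0#) → (u * v) ⁻¹ ≈ u ⁻¹ * v ⁻¹
  ⁻¹-distrib-* u v u≉0 v≉0 = sym (inverse-unique (u * v) (u ⁻¹ * v ⁻¹) (*-nonzero u≉0 v≉0) (begin
    (u * v) * (u ⁻¹ * v ⁻¹)   ≈⟨ solve 4 (λ u v a b → (u :* v) :* (a :* b) := (u :* a) :* (v :* b)) refl u v (u ⁻¹) (v ⁻¹) ⟩
    (u * u ⁻¹) * (v * v ⁻¹)   ≈⟨ *-cong (inverseʳ u u≉0) (inverseʳ v v≉0) ⟩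
    1# * 1#                   ≈⟨ *-identityˡ 1# ⟩
    1#                        ∎))

  ⁻¹-nonzero : ∀ u → ¬ (u ≈ 0#) → ¬ (u ⁻¹ ≈ 0#)
  ⁻¹-nonzero u u≉0 u⁻¹≈0 = 1≉0 (trans (sym (inverseʳ u u≉0)) (trans (*-congˡ u⁻¹≈0) (zeroʳ u)))

  ∂rising≈rising*∑<⁻¹ : ∀ u m → (∀ i → i < m → ¬ (u + ι i ≈ 0#)) →
                        ∂rising u m ≈ rising u m * ∑< (λ i → (u + ι i) ⁻¹) m
  ∂rising≈rising*∑<⁻¹ u zero    _       = sym (zeroʳ 1#)
  ∂rising≈rising*∑<⁻¹ u (suc m) nonzero = begin
    ∂rising u m * w + rising u m        ≈⟨ +-congʳ (*-congʳ (∂rising≈rising*∑<⁻¹ u m (λ i i<m → nonzero i (ℕ.m<n⇒m<1+n i<m)))) ⟩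
    rising u m * s * w + rising u m     ≈⟨ +-congˡ (trans (*-congˡ (inverseʳ w (nonzero m ℕ.≤-refl))) (*-identityʳ _)) ⟨
    rising u m * s * w + rising u m * (w * w ⁻¹)
      ≈⟨ solve 4 (λ r s w v → r :* s :* w :+ r :* (w :* v) := r :* w :* (s :+ v)) refl (rising u m) s w (w ⁻¹) ⟩
    rising u m * w * (s + w ⁻¹)         ∎
    where
    w s : Carrier
    w = u + ι m
    s = ∑< (λ i → (u + ι i) ⁻¹) m

  falling-cong : ∀ {w w′} k → w ≈ w′ → falling w k ≈ falling w′ k
  falling-cong zero    w≈w′ = refl
  falling-cong (suc k) w≈w′ = *-cong (falling-cong k w≈w′) (+-congʳ w≈w′)

  falling≈rising : ∀ w k → falling (w + ι k) k ≈ rising (w + 1#) k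
  falling≈rising w zero    = refl
  falling≈rising w (suc k) = begin
    falling (w + ι (suc k)) k * (w + ι (suc k) - ι k)
      ≈⟨ *-cong (falling-cong k (solve 2 (λ w K → w :+ (con (+ 1) :+ K) := (w :+ con (+ 1)) :+ K) refl w (ι k)))
                (solve 2 (λ w K → w :+ (con (+ 1) :+ K) :- K := w :+ con (+ 1)) refl w (ι k)) ⟩
    falling ((w + 1#) + ι k) k * (w + 1#)  ≈⟨ *-congʳ (falling≈rising (w + 1#) k) ⟩
    rising (w + 1# + 1#) k * (w + 1#)      ≈⟨ *-comm _ _ ⟩
    (w + 1#) * rising (w + 1# + 1#) k      ≈⟨ rising-suc (w + 1#) k ⟨
    rising (w + 1#) (suc k)                ∎

  ι[k!]≉0 : ∀ k → ¬ (ι (k !) ≈ 0#)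
  ι[k!]≉0 k = charZero (ℕ.pred (k !)) ∘′ trans (reflexive (≡.cong ι (ℕ.suc-pred (k !) {{k ℕ.!≢0}})))

  binom≈rising : ∀ w k → binom (w + ι k) k ≈ rising (w + 1#) k * ι (k !) ⁻¹
  binom≈rising w k = *-congʳ (falling≈rising w k)

  ÷-cancel-common-factor : ∀ r₁ r₂ r₃ r₄ f → ¬ (r₃ * r₄ ≈ 0#) → ¬ (f ≈ 0#) →
                           (r₁ * f) * (r₂ * f) ÷ ((r₃ * f) * (r₄ * f)) ≈ r₁ * r₂ * (r₃ * r₄) ⁻¹
  ÷-cancel-common-factor r₁ r₂ r₃ r₄ f r₃r₄≉0 f≉0 = begin
    (r₁ * f) * (r₂ * f) * ((r₃ * f) * (r₄ * f)) ⁻¹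
      ≈⟨ *-congˡ (⁻¹-cong (solve 5 (λ a b c d f → (a :* f) :* (b :* f) := (a :* b) :* (f :* f)) refl r₃ r₄ r₃ r₄ f)) ⟩
    (r₁ * f) * (r₂ * f) * ((r₃ * r₄) * (f * f)) ⁻¹
      ≈⟨ *-congˡ (⁻¹-distrib-* _ _ r₃r₄≉0 (*-nonzero f≉0 f≉0)) ⟩
    (r₁ * f) * (r₂ * f) * ((r₃ * r₄) ⁻¹ * (f * f) ⁻¹)
      ≈⟨ *-congˡ (*-congˡ (⁻¹-distrib-* f f f≉0 f≉0)) ⟩
    (r₁ * f) * (r₂ * f) * ((r₃ * r₄) ⁻¹ * (f ⁻¹ * f ⁻¹))
      ≈⟨ solve 5 (λ a b f q g → (a :* f) :* (b :* f) :* (q :* (g :* g)) := a :* b :* q :* ((f :* g) :* (f :* g))) refl r₁ r₂ f ((r₃ * r₄) ⁻¹) (f ⁻¹) ⟩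
    r₁ * r₂ * (r₃ * r₄) ⁻¹ * ((f * f ⁻¹) * (f * f ⁻¹))
      ≈⟨ *-congˡ (trans (*-cong (inverseʳ f f≉0) (inverseʳ f f≉0)) (*-identityˡ 1#)) ⟩
    r₁ * r₂ * (r₃ * r₄) ⁻¹ * 1#   ≈⟨ *-identityʳ _ ⟩
    r₁ * r₂ * (r₃ * r₄) ⁻¹        ∎

  sumTo≈∑< : ∀ m (f : ℕ → Carrier) → sumTo m f ≈ ∑< f (suc m)
  sumTo≈∑< zero    f = sym (+-identityˡ _)
  sumTo≈∑< (suc m) f = +-congʳ (sumTo≈∑< m f)

  H≈∑< : ∀ m y → H m y ≈ ∑< (λ i → (y + 1# + ι i) ⁻¹) m
  H≈∑< zero    y = refl
  H≈∑< (suc m) y = +-cong (H≈∑< m y) (⁻¹-cong (sym (+-assoc y 1# (ι m))))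

  H[2k]≈∑< : ∀ k x → H (2 ℕ.* k) x ≈ ∑< (λ i → (x + ι (suc (2 ℕ.* i))) ⁻¹ + (x + ι (suc (suc (2 ℕ.* i)))) ⁻¹) k
  H[2k]≈∑< zero    x = refl
  H[2k]≈∑< (suc k) x = begin
    H (2 ℕ.* suc k) x                                                        ≡⟨ ≡.cong (λ m → H m x) (2*[1+k]≡2+2*k k) ⟩
    H (2 ℕ.* k) x + (x + ι (suc (2 ℕ.* k))) ⁻¹ + (x + ι (suc (suc (2 ℕ.* k)))) ⁻¹ ≈⟨ +-assoc _ _ _ ⟩
    H (2 ℕ.* k) x + ((x + ι (suc (2 ℕ.* k))) ⁻¹ + (x + ι (suc (suc (2 ℕ.* k)))) ⁻¹) ≈⟨ +-congʳ (H[2k]≈∑< k x) ⟩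
    _ ∎

module DifferentiatedSums {c ℓ} (F : CharZeroField c ℓ) (x : CharZeroField.Carrier F) where
  open CharZeroField F
  open FieldOps F
  open ℤ-RingSolver commRing
  open FieldFacts F
  open RingBasics commRing hiding (ι)
  open DualNumbers commRing
  module Rε = CommutativeRing R[ε]
  open import Relation.Binary.Reasoning.Setoid setoid

  ½ ¼ a₀ b₀ c₀ : Carrier
  ½  = ι 2 ⁻¹
  ¼  = ι 4 ⁻¹
  a₀ = x * ½ + 1#
  b₀ = x - 1# * ½ + 1#
  c₀ = (x - 1#) * ½ + 1#

  -- p = -¼ + ε/2 and c = c₀ + ε/2, so that a = a₀ - ε/2 and b = b₀.
  module Sums = TerminatingSums R[ε] (naturalsCancellative-ε naturalsCancellative) (- (½ * ½) , ½) (c₀ , ½)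

  2*½≈1 : (1# + 1#) * ½ ≈ 1#
  2*½≈1 = trans (*-congʳ (+-congˡ (sym (+-identityʳ 1#)))) (inverseʳ (ι 2) (charZero 1))

  -- Identities involving ½ are proved by the ring solver modulo 2·½ - 1, whose cofactor w is given.
  ≈-mod-2½ : ∀ u v w → u ≈ v + w * ((1# + 1#) * ½ - 1#) → u ≈ v
  ≈-mod-2½ u v w u≈ = begin
    u                             ≈⟨ u≈ ⟩
    v + w * ((1# + 1#) * ½ - 1#)  ≈⟨ +-congˡ (*-congˡ (+-congʳ 2*½≈1)) ⟩
    v + w * (1# - 1#)             ≈⟨ solve 2 (λ v w → v :+ w :* (con (+ 1) :- con (+ 1)) := v) refl v w ⟩
    v                             ∎

  oneₛ twoₛ : ∀ {n} → Polynomial n × Polynomial n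
  oneₛ = (con (+ 1) , con (+ 0))
  twoₛ = oneₛ :+ε oneₛ

  pₛ : ∀ {n} → Polynomial n → Polynomial n × Polynomial n
  pₛ h = (:- (h :* h) , h)

  cₛ : ∀ {n} → Polynomial n → Polynomial n → Polynomial n × Polynomial n
  cₛ x h = ((x :- con (+ 1)) :* h :+ con (+ 1) , h)

  aₛ bₛ : ∀ {n} → Polynomial n → Polynomial n → Polynomial n × Polynomial n
  aₛ x h = cₛ x h :-ε twoₛ :*ε pₛ h
  bₛ x h = twoₛ :*ε cₛ x h :-ε twoₛ :*ε pₛ h :-ε oneₛ

  a≈ : Sums.a ≈ε (a₀ , - ½)
  a≈ = ≈-mod-2½ _ _ ½ (solve 2 (λ x h → proj₁ (aₛ x h) := x :* h :+ con (+ 1) :+ h :* (con (+ 2) :* h :- con (+ 1))) refl x ½)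
     , solve 2 (λ x h → proj₂ (aₛ x h) := :- h) refl x ½

  b≈ : Sums.b ≈ε (b₀ , 0#)
  b≈ = ≈-mod-2½ _ _ (x + ½) (solve 2 (λ x h → proj₁ (bₛ x h)
                                 := x :- con (+ 1) :* h :+ con (+ 1) :+ (x :+ h) :* (con (+ 2) :* h :- con (+ 1))) refl x ½)
     , solve 2 (λ x h → proj₂ (bₛ x h) := con (+ 0)) refl x ½

  c+k≈ : ∀ k → (c₀ , ½) +ε ε.ι k ≈ε (c₀ + ι k , ½)
  c+k≈ k = +-congˡ (proj₁ (ι-ε k)) , trans (+-congˡ (proj₂ (ι-ε k))) (+-identityʳ ½)

  b+n+k+e≈ : ∀ n k e → Sums.b +ε ε.ι n +ε ε.ι k +ε ε.ι e ≈ε (b₀ + ι n + ι k + ι e , 0#)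
  b+n+k+e≈ n k e =
    +-cong (+-cong (+-cong (proj₁ b≈) (proj₁ (ι-ε n))) (proj₁ (ι-ε k))) (proj₁ (ι-ε e)) ,
    trans (+-cong (+-cong (+-cong (proj₂ b≈) (proj₂ (ι-ε n))) (proj₂ (ι-ε k))) (proj₂ (ι-ε e)))
          (solve 0 (con (+ 0) :+ con (+ 0) :+ con (+ 0) :+ con (+ 0) := con (+ 0)) refl)

  sgn≈ : ∀ k → Sums.sgn k ≈ε (sgn k , 0#)
  sgn≈ zero    = refl , refl
  sgn≈ (suc k) = -‿cong (proj₁ (sgn≈ k)) , trans (-‿cong (proj₂ (sgn≈ k))) (solve 0 (:- con (+ 0) := con (+ 0)) refl)

  rising≈ : ∀ {u} u₀ u′ m → u ≈ε (u₀ , u′) → ε.rising u m ≈ε (rising u₀ m , u′ * ∂rising u₀ m)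
  rising≈ u₀ u′ m u≈ = Rε.trans (ε.rising-cong m u≈) (rising-ε u₀ u′ m)

  term-value : ℕ → ℕ → ℕ → Carrier
  term-value e n k = sgn k * ι (n C k) * rising a₀ k * rising b₀ k
                     * rising (c₀ + ι k) (n ∸ k) * rising (b₀ + ι n + ι k + ι e) (n ∸ k)

  term-derivative : ℕ → ℕ → ℕ → Carrier
  term-derivative e n k = sgn k * ι (n C k) * rising b₀ k * rising (b₀ + ι n + ι k + ι e) (n ∸ k)
    * ((- ½) * ∂rising a₀ k * rising (c₀ + ι k) (n ∸ k) + rising a₀ k * (½ * ∂rising (c₀ + ι k) (n ∸ k)))

  term≈ : ∀ e n k → Sums.term e n k ≈ε (term-value e n k , term-derivative e n k)
  term≈ e n k = Rε.trans (((((sgn≈ k ⋆ ι-ε (n C k)) ⋆ rising≈ a₀ (- ½) k a≈) ⋆ rising≈ b₀ 0# k b≈)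
                           ⋆ rising≈ (c₀ + ι k) ½ (n ∸ k) (c+k≈ k))
                           ⋆ rising≈ (b₀ + ι n + ι k + ι e) 0# (n ∸ k) (b+n+k+e≈ n k e))
                         (refl , product-rule)
    where
    open Rε using () renaming (*-cong to _⋆_)
    A B Cc Bb : Carrier
    A  = rising a₀ k
    B  = rising b₀ k
    Cc = rising (c₀ + ι k) (n ∸ k)
    Bb = rising (b₀ + ι n + ι k + ι e) (n ∸ k)
    product-rule : proj₂ ((sgn k , 0#) *ε (ι (n C k) , 0#) *ε (A , - ½ * ∂rising a₀ k) *ε (B , 0# * ∂rising b₀ k)
                          *ε (Cc , ½ * ∂rising (c₀ + ι k) (n ∸ k)) *ε (Bb , 0# * ∂rising (b₀ + ι n + ι k + ι e) (n ∸ k)))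
                   ≈ term-derivative e n k
    product-rule = solve 11 (λ s C A dA B dB Cc dC Bb dBb h → let z = con (+ 0) in
      proj₂ ((s , z) :*ε (C , z) :*ε (A , :- h :* dA) :*ε (B , z :* dB) :*ε (Cc , h :* dC) :*ε (Bb , z :* dBb))
        := s :* C :* B :* Bb :* ((:- h) :* dA :* Cc :+ A :* (h :* dC))) refl
      (sgn k) (ι (n C k)) A (∂rising a₀ k) B (∂rising b₀ k) Cc (∂rising (c₀ + ι k) (n ∸ k)) Bb (∂rising (b₀ + ι n + ι k + ι e) (n ∸ k)) ½

  ¼≈½*½ : ¼ ≈ ½ * ½
  ¼≈½*½ = sym (inverse-unique (ι 4) (½ * ½) (charZero 3) (begin
    ι 4 * (½ * ½)                      ≈⟨ solve 1 (λ h → ιₛ 4 :* (h :* h) := (con (+ 2) :* h) :* (con (+ 2) :* h)) refl ½ ⟩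
    ((1# + 1#) * ½) * ((1# + 1#) * ½)  ≈⟨ *-cong 2*½≈1 2*½≈1 ⟩
    1# * 1#                            ≈⟨ *-identityˡ 1# ⟩
    1#                                 ∎))

  α₁ β₁ α₂ β₂ : Carrier
  α₁ = x * ½ - ½ * ½ + 1#
  β₁ = - (ι 3 * (½ * ½)) + 1#
  α₂ = x * ½ - ι 3 * (½ * ½) + 1#
  β₂ = - (ι 5 * (½ * ½)) + 1#

  ρ₁≈ : ∀ n → Sums.ρ₁ n ≈ε (ι 4 * (α₁ + ι n) * (β₁ + ι n) , ι 4 * (α₁ + ι n) * ½)
  ρ₁≈ n = Rε.trans (Rε.*-cong (Rε.*-congˡ (Rε.+-congˡ (Rε.*-congˡ (ι-ε n)))) (Rε.+-congˡ (ι-ε n)))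
    ( ≈-mod-2½ _ _ _ (solve 3 (λ x h N → proj₁ (ρₛ x h N)
        := ιₛ 4 :* (x :* h :- h :* h :+ con (+ 1) :+ N) :* (:- (ιₛ 3 :* (h :* h)) :+ con (+ 1) :+ N)
           :+ (con (+ 2) :+ con (+ 2) :* N :+ con (+ 8) :* N :* h :+ con (+ 6) :* h :+ con (+ 2) :* h :* x
               :- con (+ 2) :* h :* h :+ con (+ 4) :* h :* h :* x :- con (+ 8) :* h :* h :* h)
              :* (con (+ 2) :* h :- con (+ 1))) refl x ½ (ι n))
    , ≈-mod-2½ _ _ _ (solve 3 (λ x h N → proj₂ (ρₛ x h N)
        := ιₛ 4 :* (x :* h :- h :* h :+ con (+ 1) :+ N) :* h
           :+ (con (+ 4) :* h :* h) :* (con (+ 2) :* h :- con (+ 1))) refl x ½ (ι n)))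
    where
    ρₛ : ∀ {m} → Polynomial m → Polynomial m → Polynomial m → Polynomial m × Polynomial m
    ρₛ x h N = twoₛ :*ε (twoₛ :*ε pₛ h :+ε oneₛ :+ε twoₛ :*ε (N , con (+ 0))) :*ε (cₛ x h :-ε pₛ h :+ε (N , con (+ 0)))

  ρ₂≈ : ∀ n → Sums.ρ₂ n ≈ε (ι 4 * (α₂ + ι n) * (β₂ + ι n) , ι 4 * (α₂ + ι n) * ½)
  ρ₂≈ n = Rε.trans (Rε.*-cong (Rε.*-congˡ (Rε.+-congˡ (ι-ε n))) (Rε.+-congˡ (Rε.*-congˡ (ι-ε n))))
    ( ≈-mod-2½ _ _ _ (solve 3 (λ x h N → proj₁ (ρₛ x h N)
        := ιₛ 4 :* (x :* h :- ιₛ 3 :* (h :* h) :+ con (+ 1) :+ N) :* (:- (ιₛ 5 :* (h :* h)) :+ con (+ 1) :+ N)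
           :+ (con (+ 4) :+ con (+ 6) :* N :+ con (+ 16) :* N :* h :+ con (+ 8) :* h :+ con (+ 4) :* h :* x
               :- con (+ 14) :* h :* h :+ con (+ 8) :* h :* h :* x :- con (+ 32) :* h :* h :* h)
              :* (con (+ 2) :* h :- con (+ 1))) refl x ½ (ι n))
    , ≈-mod-2½ _ _ _ (solve 3 (λ x h N → proj₂ (ρₛ x h N)
        := ιₛ 4 :* (x :* h :- ιₛ 3 :* (h :* h) :+ con (+ 1) :+ N) :* h
           :+ (con (+ 2) :* h :+ con (+ 8) :* h :* h) :* (con (+ 2) :* h :- con (+ 1))) refl x ½ (ι n)))
    where
    ρₛ : ∀ {m} → Polynomial m → Polynomial m → Polynomial m → Polynomial m × Polynomial m
    ρₛ x h N = twoₛ :*ε (pₛ h :+ε (N , con (+ 0))) :*ε (bₛ x h :+ε twoₛ :*ε (N , con (+ 0)))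

  ∏<≈ : ∀ (ρ : ℕ → Carrier × Carrier) α β γ →
        (∀ n → ρ n ≈ε (ι 4 * (α + ι n) * (β + ι n) , ι 4 * (α + ι n) * ½)) →
        (∀ n → γ + ι (suc n) ≈ β + ι n) → (∀ n → ¬ (γ + ι (suc n) ≈ 0#)) →
        ∀ n → ε.∏< ρ n ≈ε (pow (ι 4) n * (rising α n * rising β n) , pow (ι 4) n * (rising α n * rising β n) * ½ * H n γ)
  ∏<≈ ρ α β γ ρ≈ γ≈ γ≉0 zero =
    solve 0 (con (+ 1) := con (+ 1) :* (con (+ 1) :* con (+ 1))) refl ,
    solve 1 (λ h → con (+ 0) := con (+ 1) :* (con (+ 1) :* con (+ 1)) :* h :* con (+ 0)) refl ½
  ∏<≈ ρ α β γ ρ≈ γ≈ γ≉0 (suc n) = Rε.trans (Rε.*-cong (∏<≈ ρ α β γ ρ≈ γ≈ γ≉0 n) (ρ≈ n)) (value , derivative)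
    where
    P Rα Rβ u v w : Carrier
    P  = pow (ι 4) n
    Rα = rising α n
    Rβ = rising β n
    u  = α + ι n
    v  = β + ι n
    w  = γ + ι (suc n)
    value : P * (Rα * Rβ) * (ι 4 * u * v) ≈ ι 4 * P * (Rα * u * (Rβ * v))
    value = solve 6 (λ P Rα Rβ f u v → P :* (Rα :* Rβ) :* (f :* u :* v) := f :* P :* (Rα :* u :* (Rβ :* v))) refl P Rα Rβ (ι 4) u v
    derivative : P * (Rα * Rβ) * (ι 4 * u * ½) + P * (Rα * Rβ) * ½ * H n γ * (ι 4 * u * v)
                 ≈ ι 4 * P * (Rα * u * (Rβ * v)) * ½ * (H n γ + w ⁻¹)
    derivative = begin
      P * (Rα * Rβ) * (ι 4 * u * ½) + P * (Rα * Rβ) * ½ * H n γ * (ι 4 * u * v)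
        ≈⟨ +-congʳ (trans (*-congˡ (trans (*-congʳ (sym (γ≈ n))) (inverseʳ w (γ≉0 n)))) (*-identityʳ _)) ⟨
      P * (Rα * Rβ) * (ι 4 * u * ½) * (v * w ⁻¹) + P * (Rα * Rβ) * ½ * H n γ * (ι 4 * u * v)
        ≈⟨ solve 9 (λ P Rα Rβ f u v h g i → P :* (Rα :* Rβ) :* (f :* u :* h) :* (v :* i) :+ P :* (Rα :* Rβ) :* h :* g :* (f :* u :* v)
                                            := f :* P :* (Rα :* u :* (Rβ :* v)) :* h :* (g :+ i)) refl P Rα Rβ (ι 4) u v ½ (H n γ) (w ⁻¹) ⟩
      ι 4 * P * (Rα * u * (Rβ * v)) * ½ * (H n γ + w ⁻¹) ∎

  γ₁ γ₂ : Carrier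
  γ₁ = - (ι 3 ÷ ι 4)
  γ₂ = - (ι 5 ÷ ι 4)

  γ+[1+n]≈ : ∀ k n → - (ι k ÷ ι 4) + ι (suc n) ≈ (- (ι k * (½ * ½)) + 1#) + ι n
  γ+[1+n]≈ k n = trans (+-congʳ (-‿cong (*-congˡ ¼≈½*½))) (sym (+-assoc _ 1# (ι n)))

  4*[γ+j]≈ : ∀ k j → ι 4 * (- (ι k ÷ ι 4) + ι j) ≈ ι (j ℕ.* 4) - ι k
  4*[γ+j]≈ k j = begin
    ι 4 * (- (ι k ÷ ι 4) + ι j)   ≈⟨ solve 4 (λ f k q j → f :* (:- (k :* q) :+ j) := j :* f :- k :* (f :* q)) refl (ι 4) (ι k) ¼ (ι j) ⟩
    ι j * ι 4 - ι k * (ι 4 * ¼)   ≈⟨ +-cong (sym (ι-homo-* j 4)) (-‿cong (trans (*-congˡ (inverseʳ (ι 4) (charZero 3))) (*-identityʳ _))) ⟩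
    ι (j ℕ.* 4) - ι k             ∎

  ι[k+m]-ι[k]≈ι[m] : ∀ k m → ι (k ℕ.+ m) - ι k ≈ ι m
  ι[k+m]-ι[k]≈ι[m] k m = trans (+-congʳ (ι-homo-+ k m)) (solve 2 (λ k m → k :+ m :- k := m) refl (ι k) (ι m))

  nonzero-if-4*≈ι : ∀ {w} m → ι 4 * w ≈ ι (suc m) → ¬ (w ≈ 0#)
  nonzero-if-4*≈ι {w} m 4w≈ w≈0 = charZero m (trans (sym 4w≈) (trans (*-congˡ w≈0) (zeroʳ _)))

  γ₁+[1+n]≉0 : ∀ n → ¬ (γ₁ + ι (suc n) ≈ 0#)
  γ₁+[1+n]≉0 n = nonzero-if-4*≈ι (n ℕ.* 4) (trans (4*[γ+j]≈ 3 (suc n)) (ι[k+m]-ι[k]≈ι[m] 3 (suc (n ℕ.* 4))))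

  γ₂+[1+n]≉0 : ∀ n → ¬ (γ₂ + ι (suc n) ≈ 0#)
  γ₂+[1+n]≉0 zero    w≈0 = 1≉0 (begin
    1#                        ≈⟨ solve 0 (con (+ 1) := :- (ιₛ 4 :- ιₛ 5)) refl ⟩
    - (ι (1 ℕ.* 4) - ι 5)     ≈⟨ -‿cong (4*[γ+j]≈ 5 1) ⟨
    - (ι 4 * (γ₂ + ι 1))      ≈⟨ -‿cong (trans (*-congˡ w≈0) (zeroʳ _)) ⟩
    - 0#                      ≈⟨ solve 0 (:- con (+ 0) := con (+ 0)) refl ⟩
    0#                        ∎)
  γ₂+[1+n]≉0 (suc m) = nonzero-if-4*≈ι (suc (suc (m ℕ.* 4))) (trans (4*[γ+j]≈ 5 (suc (suc m))) (ι[k+m]-ι[k]≈ι[m] 5 (suc (suc (suc (m ℕ.* 4))))))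

  ∏<ρ₁≈ : ∀ n → ε.∏< Sums.ρ₁ n ≈ε (pow (ι 4) n * (rising α₁ n * rising β₁ n) , pow (ι 4) n * (rising α₁ n * rising β₁ n) * ½ * H n γ₁)
  ∏<ρ₁≈ = ∏<≈ Sums.ρ₁ α₁ β₁ γ₁ ρ₁≈ (γ+[1+n]≈ 3) γ₁+[1+n]≉0

  ∏<ρ₂≈ : ∀ n → ε.∏< Sums.ρ₂ n ≈ε (pow (ι 4) n * (rising α₂ n * rising β₂ n) , pow (ι 4) n * (rising α₂ n * rising β₂ n) * ½ * H n γ₂)
  ∏<ρ₂≈ = ∏<≈ Sums.ρ₂ α₂ β₂ γ₂ ρ₂≈ (γ+[1+n]≈ 5) γ₂+[1+n]≉0

  ∑<-term≈ : ∀ n → ε.∑< (Sums.term 0 n) (suc n) ≈ε (∑< (term-value 0 n) (suc n) , ∑< (term-derivative 0 n) (suc n))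
  ∑<-term≈ n = Rε.trans (∑<-ε (Sums.term 0 n) (suc n))
                 (∑<-cong (suc n) (λ k _ → proj₁ (term≈ 0 n k)) , ∑<-cong (suc n) (λ k _ → proj₂ (term≈ 0 n k)))

  Π₁ Π₂ : ℕ → Carrier
  Π₁ n = pow (ι 4) n * (rising α₁ n * rising β₁ n)
  Π₂ n = pow (ι 4) n * (rising α₂ n * rising β₂ n)

  two*∑<-term≈ : ∀ n → Sums.two *ε (∑< (term-value 0 n) (suc n) , ∑< (term-derivative 0 n) (suc n))
                       ≈ε (Π₁ n , Π₁ n * ½ * H n γ₁) +ε (Π₂ n , Π₂ n * ½ * H n γ₂)
  two*∑<-term≈ n = Rε.trans (Rε.*-congˡ (Rε.sym (∑<-term≈ n)))
                     (Rε.trans (Sums.two*∑<-term₀ n) (Rε.+-cong (∏<ρ₁≈ n) (∏<ρ₂≈ n)))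

  two*∑<-term-value : ∀ n → (1# + 1#) * ∑< (term-value 0 n) (suc n) ≈ Π₁ n + Π₂ n
  two*∑<-term-value n = proj₁ (two*∑<-term≈ n)

  two*∑<-term-derivative : ∀ n → (1# + 1#) * ∑< (term-derivative 0 n) (suc n) ≈ Π₁ n * ½ * H n γ₁ + Π₂ n * ½ * H n γ₂
  two*∑<-term-derivative n = trans (solve 2 (λ d v → con (+ 2) :* d := con (+ 2) :* d :+ (con (+ 0) :+ con (+ 0)) :* v) refl _ _)
                                   (proj₂ (two*∑<-term≈ n))


  a₀+i≈ : ∀ i → a₀ + ι i ≈ (x + ι (suc (suc (2 ℕ.* i)))) * ½
  a₀+i≈ i = trans (≈-mod-2½ _ _ _ (solve 3 (λ x h N → x :* h :+ con (+ 1) :+ N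
                     := (x :+ (con (+ 1) :+ (con (+ 1) :+ ιₛ 2 :* N))) :* h :+ (:- (con (+ 1) :+ N)) :* (con (+ 2) :* h :- con (+ 1))) refl x ½ (ι i)))
                  (*-congʳ (+-congˡ (+-congˡ (+-congˡ (sym (ι-homo-* 2 i))))))

  c₀+i≈ : ∀ i → c₀ + ι i ≈ (x + ι (suc (2 ℕ.* i))) * ½
  c₀+i≈ i = trans (≈-mod-2½ _ _ _ (solve 3 (λ x h N → (x :- con (+ 1)) :* h :+ con (+ 1) :+ N
                     := (x :+ (con (+ 1) :+ ιₛ 2 :* N)) :* h :+ (:- (con (+ 1) :+ N)) :* (con (+ 2) :* h :- con (+ 1))) refl x ½ (ι i)))
                  (*-congʳ (+-congˡ (+-congˡ (sym (ι-homo-* 2 i)))))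

  ½≉0 : ¬ (½ ≈ 0#)
  ½≉0 = ⁻¹-nonzero (ι 2) (charZero 1)

  ⁻¹-half : ∀ u v → ¬ (u ≈ 0#) → v ≈ u * ½ → v ⁻¹ ≈ ι 2 * u ⁻¹
  ⁻¹-half u v u≉0 v≈u½ = begin
    v ⁻¹              ≈⟨ ⁻¹-cong v≈u½ ⟩
    (u * ½) ⁻¹        ≈⟨ ⁻¹-distrib-* u ½ u≉0 ½≉0 ⟩
    u ⁻¹ * ½ ⁻¹       ≈⟨ *-congˡ (sym (inverse-unique ½ (ι 2) ½≉0 (trans (*-comm ½ (ι 2)) (inverseʳ (ι 2) (charZero 1))))) ⟩
    u ⁻¹ * ι 2        ≈⟨ *-comm _ _ ⟩
    ι 2 * u ⁻¹        ∎

  module Identity (n : ℕ)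
    (x+j≉0 : ∀ j → 1 ≤ j → j ≤ 2 ℕ.* n → ¬ ((x + ι j) ≈ 0#))
    (y+j≉0 : ∀ j → 1 ≤ j → j ≤ n → ¬ (((x - 1#) ÷ ι 2 + ι j) ≈ 0#))
    (binom₁≉0 : ∀ k → k ≤ n → ¬ (binom ((x - 1#) ÷ ι 2 + ι k) k ≈ 0#))
    (binom₂≉0 : ∀ k → k ≤ n → ¬ (binom (x - 1# ÷ ι 2 + ι n + ι k) k ≈ 0#)) where

    2+2i≤2n : ∀ i → i < n → suc (suc (2 ℕ.* i)) ≤ 2 ℕ.* n
    2+2i≤2n i i<n = ≡.subst (_≤ 2 ℕ.* n) (2*[1+k]≡2+2*k i) (ℕ.*-monoʳ-≤ 2 i<n)

    x+[1+2i]≉0 : ∀ i → i < n → ¬ (x + ι (suc (2 ℕ.* i)) ≈ 0#)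
    x+[1+2i]≉0 i i<n = x+j≉0 _ (s≤s z≤n) (ℕ.≤-trans (ℕ.n≤1+n _) (2+2i≤2n i i<n))

    x+[2+2i]≉0 : ∀ i → i < n → ¬ (x + ι (suc (suc (2 ℕ.* i))) ≈ 0#)
    x+[2+2i]≉0 i i<n = x+j≉0 _ (s≤s z≤n) (2+2i≤2n i i<n)

    c₀+i≉0 : ∀ i → i < n → ¬ (c₀ + ι i ≈ 0#)
    c₀+i≉0 i i<n = y+j≉0 (suc i) (s≤s z≤n) i<n ∘ trans (sym (+-assoc _ 1# (ι i)))

    a₀+i≉0 : ∀ i → i < n → ¬ (a₀ + ι i ≈ 0#)
    a₀+i≉0 i i<n = *-nonzero (x+[2+2i]≉0 i i<n) ½≉0 ∘ trans (sym (a₀+i≈ i))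

    h : Carrier
    h = H n ((x - 1#) ÷ ι 2)

    ∑a₀⁻¹+∑c₀⁻¹≈2H[2k] : ∀ k → k ≤ n → ∑< (λ i → (a₀ + ι i) ⁻¹) k + ∑< (λ i → (c₀ + ι i) ⁻¹) k ≈ ι 2 * H (2 ℕ.* k) x
    ∑a₀⁻¹+∑c₀⁻¹≈2H[2k] k k≤n = begin
      ∑< (λ i → (a₀ + ι i) ⁻¹) k + ∑< (λ i → (c₀ + ι i) ⁻¹) k ≈⟨ ∑<-distrib-+ _ _ k ⟨
      ∑< (λ i → (a₀ + ι i) ⁻¹ + (c₀ + ι i) ⁻¹) k
        ≈⟨ ∑<-cong k (λ i i<k → trans (+-cong (⁻¹-half _ _ (x+[2+2i]≉0 i (ℕ.<-≤-trans i<k k≤n)) (a₀+i≈ i))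
                                               (⁻¹-half _ _ (x+[1+2i]≉0 i (ℕ.<-≤-trans i<k k≤n)) (c₀+i≈ i)))
                                        (solve 3 (λ t u v → t :* u :+ t :* v := t :* (v :+ u)) refl (ι 2) _ _)) ⟩
      ∑< (λ i → ι 2 * ((x + ι (suc (2 ℕ.* i))) ⁻¹ + (x + ι (suc (suc (2 ℕ.* i)))) ⁻¹)) k ≈⟨ ∑<-distribˡ-* (ι 2) _ k ⟩
      ι 2 * ∑< (λ i → (x + ι (suc (2 ℕ.* i))) ⁻¹ + (x + ι (suc (suc (2 ℕ.* i)))) ⁻¹) k ≈⟨ *-congˡ (H[2k]≈∑< k x) ⟨
      ι 2 * H (2 ℕ.* k) x ∎

    ∑[c₀+k+i]⁻¹≈h-∑c₀⁻¹ : ∀ k → k ≤ n → ∑< (λ i → (c₀ + ι k + ι i) ⁻¹) (n ∸ k) ≈ h - ∑< (λ i → (c₀ + ι i) ⁻¹) k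
    ∑[c₀+k+i]⁻¹≈h-∑c₀⁻¹ k k≤n = begin
      S′ ≈⟨ solve 2 (λ a b → a := (b :+ a) :- b) refl S′ S₀ ⟩
      (S₀ + S′) - S₀
        ≈⟨ +-congʳ (+-congˡ (∑<-cong (n ∸ k) (λ i _ → ⁻¹-cong (trans (+-assoc c₀ (ι k) (ι i)) (+-congˡ (sym (ι-homo-+ k i))))))) ⟩
      (S₀ + ∑< (λ i → (c₀ + ι (k ℕ.+ i)) ⁻¹) (n ∸ k)) - S₀ ≈⟨ +-congʳ (∑<-+ (λ i → (c₀ + ι i) ⁻¹) k (n ∸ k)) ⟨
      ∑< (λ i → (c₀ + ι i) ⁻¹) (k ℕ.+ (n ∸ k)) - S₀        ≡⟨ ≡.cong (λ m → ∑< (λ i → (c₀ + ι i) ⁻¹) m - S₀) (ℕ.m+[n∸m]≡n k≤n) ⟩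
      ∑< (λ i → (c₀ + ι i) ⁻¹) n - S₀                      ≈⟨ +-congʳ (H≈∑< n ((x - 1#) ÷ ι 2)) ⟨
      h - S₀ ∎
      where
      S′ S₀ : Carrier
      S′ = ∑< (λ i → (c₀ + ι k + ι i) ⁻¹) (n ∸ k)
      S₀ = ∑< (λ i → (c₀ + ι i) ⁻¹) k

    term-derivative≈ : ∀ k → k ≤ n → term-derivative 0 n k ≈ term-value 0 n k * (½ * h - H (2 ℕ.* k) x)
    term-derivative≈ k k≤n = begin
      term-derivative 0 n k ≈⟨ *-congˡ (+-cong (*-congʳ (*-congˡ ∂A≈)) (*-congˡ (*-congˡ ∂Cc≈))) ⟩
      S * Ck * B * Bb * ((- ½) * (A * ΣA) * Cc + A * (½ * (Cc * ΣC)))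
        ≈⟨ solve 9 (λ S Ck A B Cc Bb h sa sc → S :* Ck :* B :* Bb :* ((:- h) :* (A :* sa) :* Cc :+ A :* (h :* (Cc :* sc)))
                                            := S :* Ck :* A :* B :* Cc :* Bb :* (h :* (sc :- sa))) refl S Ck A B Cc Bb ½ ΣA ΣC ⟩
      term-value 0 n k * (½ * (ΣC - ΣA))            ≈⟨ *-congˡ (*-congˡ (+-congʳ (∑[c₀+k+i]⁻¹≈h-∑c₀⁻¹ k k≤n))) ⟩
      term-value 0 n k * (½ * ((h - ΣC₀) - ΣA))
        ≈⟨ *-congˡ (solve 4 (λ i h c a → i :* ((h :- c) :- a) := i :* h :- i :* (a :+ c)) refl ½ h ΣC₀ ΣA) ⟩
      term-value 0 n k * (½ * h - ½ * (ΣA + ΣC₀))   ≈⟨ *-congˡ (+-congˡ (-‿cong (*-congˡ (∑a₀⁻¹+∑c₀⁻¹≈2H[2k] k k≤n)))) ⟩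
      term-value 0 n k * (½ * h - ½ * (ι 2 * H (2 ℕ.* k) x))
        ≈⟨ *-congˡ (+-congˡ (-‿cong (trans (sym (*-assoc _ _ _)) (trans (*-congʳ (trans (*-comm ½ (ι 2)) (inverseʳ (ι 2) (charZero 1)))) (*-identityˡ _))))) ⟩
      term-value 0 n k * (½ * h - H (2 ℕ.* k) x) ∎
      where
      S Ck A B Cc Bb ΣA ΣC₀ ΣC : Carrier
      S   = sgn k
      Ck  = ι (n C k)
      A   = rising a₀ k
      B   = rising b₀ k
      Cc  = rising (c₀ + ι k) (n ∸ k)
      Bb  = rising (b₀ + ι n + ι k + ι 0) (n ∸ k)
      ΣA  = ∑< (λ i → (a₀ + ι i) ⁻¹) k
      ΣC₀ = ∑< (λ i → (c₀ + ι i) ⁻¹) k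
      ΣC  = ∑< (λ i → (c₀ + ι k + ι i) ⁻¹) (n ∸ k)
      ∂A≈ : ∂rising a₀ k ≈ A * ΣA
      ∂A≈ = ∂rising≈rising*∑<⁻¹ a₀ k (λ i i<k → a₀+i≉0 i (ℕ.<-≤-trans i<k k≤n))
      ∂Cc≈ : ∂rising (c₀ + ι k) (n ∸ k) ≈ Cc * ΣC
      ∂Cc≈ = ∂rising≈rising*∑<⁻¹ (c₀ + ι k) (n ∸ k) (λ i i<n∸k c₀+k+i≈0 →
               c₀+i≉0 (k ℕ.+ i) (≡.subst (k ℕ.+ i <_) (ℕ.m+[n∸m]≡n k≤n) (ℕ.+-monoʳ-< k i<n∸k))
                      (trans (+-congˡ (ι-homo-+ k i)) (trans (sym (+-assoc c₀ (ι k) (ι i))) c₀+k+i≈0)))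

    W : Carrier
    W = Π₁ n * (h - H n γ₁) + Π₂ n * (h - H n γ₂)

    -- ∑ value·H₂ₖ = ½ h ∑ value - ∑ derivative, and both sums on the right are known.
    ∑<-term-value*H≈ : ∑< (λ k → term-value 0 n k * H (2 ℕ.* k) x) (suc n) ≈ ½ * ½ * W
    ∑<-term-value*H≈ = begin
      Σ ≈⟨ ≈-mod-2½ _ _ (- Σ) (solve 2 (λ p i → p := i :* (con (+ 2) :* p) :+ (:- p) :* (con (+ 2) :* i :- con (+ 1))) refl Σ ½) ⟩
      ½ * ((1# + 1#) * Σ) ≈⟨ *-congˡ two*Σ≈ ⟩
      ½ * (½ * W)         ≈⟨ *-assoc _ _ _ ⟨
      ½ * ½ * W           ∎
      where
      Σ Σᵥ Σ′ : Carrier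
      Σ  = ∑< (λ k → term-value 0 n k * H (2 ℕ.* k) x) (suc n)
      Σᵥ = ∑< (term-value 0 n) (suc n)
      Σ′ = ∑< (term-derivative 0 n) (suc n)
      Σ′≈ : Σ′ ≈ ½ * h * Σᵥ - Σ
      Σ′≈ = begin
        Σ′ ≈⟨ ∑<-cong (suc n) (λ k k<1+n → trans (term-derivative≈ k (ℕ.≤-pred k<1+n))
                (solve 3 (λ p a g → p :* (a :- g) := a :* p :+ (:- con (+ 1)) :* (p :* g)) refl (term-value 0 n k) (½ * h) (H (2 ℕ.* k) x))) ⟩
        ∑< (λ k → ½ * h * term-value 0 n k + (- 1#) * (term-value 0 n k * H (2 ℕ.* k) x)) (suc n)
          ≈⟨ ∑<-linear (½ * h) (- 1#) (term-value 0 n) (λ k → term-value 0 n k * H (2 ℕ.* k) x) (suc n) ⟩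
        ½ * h * Σᵥ + (- 1#) * Σ ≈⟨ solve 2 (λ a b → a :+ (:- con (+ 1)) :* b := a :- b) refl _ Σ ⟩
        ½ * h * Σᵥ - Σ ∎
      two*Σ≈ : (1# + 1#) * Σ ≈ ½ * W
      two*Σ≈ = begin
        (1# + 1#) * Σ
          ≈⟨ solve 4 (λ p a s d → con (+ 2) :* p := a :* (con (+ 2) :* s) :- con (+ 2) :* (a :* s :- p)) refl Σ (½ * h) Σᵥ Σ′ ⟩
        ½ * h * ((1# + 1#) * Σᵥ) - (1# + 1#) * (½ * h * Σᵥ - Σ)
          ≈⟨ +-cong (*-congˡ (two*∑<-term-value n)) (-‿cong (*-congˡ (sym Σ′≈))) ⟩
        ½ * h * (Π₁ n + Π₂ n) - (1# + 1#) * Σ′ ≈⟨ +-congˡ (-‿cong (two*∑<-term-derivative n)) ⟩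
        ½ * h * (Π₁ n + Π₂ n) - (Π₁ n * ½ * H n γ₁ + Π₂ n * ½ * H n γ₂)
          ≈⟨ solve 6 (λ i h X Y a b → i :* h :* (X :+ Y) :- (X :* i :* a :+ Y :* i :* b) := i :* (X :* (h :- a) :+ Y :* (h :- b)))
                     refl ½ h (Π₁ n) (Π₂ n) (H n γ₁) (H n γ₂) ⟩
        ½ * W ∎

    bₙ D : Carrier
    bₙ = x - 1# ÷ ι 2 + ι n + 1#
    D  = rising c₀ n * rising bₙ n

    rising-c₀*rising-bₙ≉0 : ∀ k → k ≤ n → ¬ (rising c₀ k * rising bₙ k ≈ 0#)
    rising-c₀*rising-bₙ≉0 k k≤n = *-nonzero (vanishing-binom (binom₁≉0 k k≤n) (binom≈rising ((x - 1#) ÷ ι 2) k))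
                                            (vanishing-binom (binom₂≉0 k k≤n) (binom≈rising (x - 1# ÷ ι 2 + ι n) k))
      where
      vanishing-binom : ∀ {u r} → ¬ (u ≈ 0#) → u ≈ r * ι (k !) ⁻¹ → ¬ (r ≈ 0#)
      vanishing-binom u≉0 u≈ r≈0 = u≉0 (trans u≈ (trans (*-congʳ r≈0) (zeroˡ _)))

    summand : ℕ → Carrier
    summand k = sgn k * ι (n C k)
                * ((binom (x ÷ ι 2 + ι k) k * binom (x - 1# ÷ ι 2 + ι k) k)
                    ÷ (binom ((x - 1#) ÷ ι 2 + ι k) k * binom (x - 1# ÷ ι 2 + ι n + ι k) k))
                * H (2 ℕ.* k) x

    D*summand≈ : ∀ k → k ≤ n → D * summand k ≈ term-value 0 n k * H (2 ℕ.* k) x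
    D*summand≈ k k≤n = begin
      D * summand k
        ≈⟨ *-cong D≈ (*-congʳ (*-congˡ ratio≈)) ⟩
      (Rc * Rb) * (Cc * Bb) * (S * Ck * (Ra * Rb₀ * (Rc * Rb) ⁻¹) * Hk)
        ≈⟨ solve 9 (λ z z⁻¹ Cc Bb S Ck Ra Rb₀ Hk → z :* (Cc :* Bb) :* (S :* Ck :* (Ra :* Rb₀ :* z⁻¹) :* Hk)
                     := (z :* z⁻¹) :* (S :* Ck :* Ra :* Rb₀ :* Cc :* Bb :* Hk)) refl (Rc * Rb) ((Rc * Rb) ⁻¹) Cc Bb S Ck Ra Rb₀ Hk ⟩
      (Rc * Rb) * (Rc * Rb) ⁻¹ * (S * Ck * Ra * Rb₀ * Cc * Bb * Hk)  ≈⟨ *-congʳ (inverseʳ _ (rising-c₀*rising-bₙ≉0 k k≤n)) ⟩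
      1# * (S * Ck * Ra * Rb₀ * Cc * Bb * Hk)                        ≈⟨ *-identityˡ _ ⟩
      term-value 0 n k * H (2 ℕ.* k) x                               ∎
      where
      S Ck Ra Rb₀ Rc Rb Cc Bb Hk : Carrier
      S   = sgn k
      Ck  = ι (n C k)
      Ra  = rising a₀ k
      Rb₀ = rising b₀ k
      Rc  = rising c₀ k
      Rb  = rising bₙ k
      Cc  = rising (c₀ + ι k) (n ∸ k)
      Bb  = rising (b₀ + ι n + ι k + ι 0) (n ∸ k)
      Hk  = H (2 ℕ.* k) x
      k+[n∸k]≡n : k ℕ.+ (n ∸ k) ≡ n
      k+[n∸k]≡n = ℕ.m+[n∸m]≡n k≤n
      D≈ : D ≈ (Rc * Rb) * (Cc * Bb)
      D≈ = begin
        rising c₀ n * rising bₙ n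
          ≈⟨ *-cong (trans (rising-≡ c₀ (≡.sym k+[n∸k]≡n)) (rising-+ c₀ k (n ∸ k)))
                    (trans (rising-≡ bₙ (≡.sym k+[n∸k]≡n)) (rising-+ bₙ k (n ∸ k))) ⟩
        (Rc * Cc) * (Rb * rising (bₙ + ι k) (n ∸ k))
          ≈⟨ *-congˡ (*-congˡ (rising-cong (n ∸ k) (solve 3 (λ y N K → (y :+ N :+ con (+ 1)) :+ K := (y :+ con (+ 1)) :+ N :+ K :+ con (+ 0))
                                                         refl (x - 1# ÷ ι 2) (ι n) (ι k)))) ⟩
        (Rc * Cc) * (Rb * Bb) ≈⟨ solve 4 (λ a b c d → (a :* b) :* (c :* d) := (a :* c) :* (b :* d)) refl Rc Cc Rb Bb ⟩
        (Rc * Rb) * (Cc * Bb) ∎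
      ratio≈ : (binom (x ÷ ι 2 + ι k) k * binom (x - 1# ÷ ι 2 + ι k) k) ÷ (binom ((x - 1#) ÷ ι 2 + ι k) k * binom (x - 1# ÷ ι 2 + ι n + ι k) k)
               ≈ Ra * Rb₀ * (Rc * Rb) ⁻¹
      ratio≈ = trans (*-cong (*-cong (binom≈rising (x ÷ ι 2) k) (binom≈rising (x - 1# ÷ ι 2) k))
                             (⁻¹-cong (*-cong (binom≈rising ((x - 1#) ÷ ι 2) k) (binom≈rising (x - 1# ÷ ι 2 + ι n) k))))
                     (÷-cancel-common-factor Ra Rb₀ Rc Rb (ι (k !) ⁻¹) (rising-c₀*rising-bₙ≉0 k k≤n) (⁻¹-nonzero _ (ι[k!]≉0 k)))

    lhs≈ : sumTo n summand ≈ D ⁻¹ * (½ * ½ * W)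
    lhs≈ = begin
      sumTo n summand                 ≈⟨ *-identityˡ _ ⟨
      1# * sumTo n summand            ≈⟨ *-congʳ (trans (*-comm _ _) (inverseʳ D D≉0)) ⟨
      (D ⁻¹ * D) * sumTo n summand    ≈⟨ *-assoc _ _ _ ⟩
      D ⁻¹ * (D * sumTo n summand)    ≈⟨ *-congˡ (*-congˡ (sumTo≈∑< n summand)) ⟩
      D ⁻¹ * (D * ∑< summand (suc n)) ≈⟨ *-congˡ (∑<-distribˡ-* D summand (suc n)) ⟨
      D ⁻¹ * ∑< (λ k → D * summand k) (suc n) ≈⟨ *-congˡ (∑<-cong (suc n) (λ k k<1+n → D*summand≈ k (ℕ.≤-pred k<1+n))) ⟩
      D ⁻¹ * ∑< (λ k → term-value 0 n k * H (2 ℕ.* k) x) (suc n) ≈⟨ *-congˡ ∑<-term-value*H≈ ⟩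
      D ⁻¹ * (½ * ½ * W)              ∎
      where
      D≉0 : ¬ (D ≈ 0#)
      D≉0 = rising-c₀*rising-bₙ≉0 n ℕ.≤-refl

    rhs-term≈ : ∀ w₁ w₂ α β γ → w₁ + 1# ≈ α → w₂ + 1# ≈ β →
                pow (ι 4) n ÷ ι 4
                  * ((binom (w₁ + ι n) n * binom (w₂ + ι n) n)
                      ÷ (binom ((x - 1#) ÷ ι 2 + ι n) n * binom (x - 1# ÷ ι 2 + ι (2 ℕ.* n)) n))
                  * (h - H n γ)
                ≈ D ⁻¹ * (½ * ½ * (pow (ι 4) n * (rising α n * rising β n) * (h - H n γ)))
    rhs-term≈ w₁ w₂ α β γ w₁+1≈α w₂+1≈β = begin
      pow (ι 4) n * ¼ * (binom (w₁ + ι n) n * binom (w₂ + ι n) n ÷ (binom ((x - 1#) ÷ ι 2 + ι n) n * binom (x - 1# ÷ ι 2 + ι (2 ℕ.* n)) n)) * (h - H n γ)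
        ≈⟨ *-congʳ (*-cong (*-congˡ ¼≈½*½) (trans (*-cong (*-cong binom≈₁ binom≈₂) (⁻¹-cong (*-cong (binom≈rising ((x - 1#) ÷ ι 2) n) binom≈₄)))
                                                 (÷-cancel-common-factor _ _ _ _ (ι (n !) ⁻¹) (rising-c₀*rising-bₙ≉0 n ℕ.≤-refl) (⁻¹-nonzero _ (ι[k!]≉0 n))))) ⟩
      pow (ι 4) n * (½ * ½) * (rising α n * rising β n * D ⁻¹) * (h - H n γ)
        ≈⟨ solve 6 (λ P q r d g h → P :* q :* (r :* d) :* g := d :* (q :* (P :* r :* g))) refl (pow (ι 4) n) (½ * ½) (rising α n * rising β n) (D ⁻¹) (h - H n γ) ½ ⟩
      D ⁻¹ * (½ * ½ * (pow (ι 4) n * (rising α n * rising β n) * (h - H n γ))) ∎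
      where
      binom≈₁ : binom (w₁ + ι n) n ≈ rising α n * ι (n !) ⁻¹
      binom≈₁ = trans (binom≈rising w₁ n) (*-congʳ (rising-cong n w₁+1≈α))
      binom≈₂ : binom (w₂ + ι n) n ≈ rising β n * ι (n !) ⁻¹
      binom≈₂ = trans (binom≈rising w₂ n) (*-congʳ (rising-cong n w₂+1≈β))
      binom≈₄ : binom (x - 1# ÷ ι 2 + ι (2 ℕ.* n)) n ≈ rising bₙ n * ι (n !) ⁻¹
      binom≈₄ = *-congʳ (trans (falling-cong n (trans (+-congˡ (ι-homo-* 2 n))
                                                       (solve 2 (λ w N → w :+ ιₛ 2 :* N := (w :+ N) :+ N) refl (x - 1# ÷ ι 2) (ι n))))
                               (falling≈rising (x - 1# ÷ ι 2 + ι n) n))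

theorem4 : ∀ {c ℓ} (F : CharZeroField c ℓ) →
             let open CharZeroField F in
             let open FieldOps F in
             (n : ℕ) (x : Carrier) →
             -- all the expressions are defined: every denominator is nonzero
             (∀ j → 1 ≤ j → j ≤ 2 ℕ.* n → ¬ ((x + ι j) ≈ 0#)) →
             (∀ j → 1 ≤ j → j ≤ n → ¬ (((x - 1#) ÷ ι 2 + ι j) ≈ 0#)) →
             (∀ k → k ≤ n → ¬ (binom ((x - 1#) ÷ ι 2 + ι k) k ≈ 0#)) →
             (∀ k → k ≤ n → ¬ (binom (x - 1# ÷ ι 2 + ι n + ι k) k ≈ 0#)) →
             sumTo n (λ k →
                 sgn k * ι (n C k)
                 * ((binom (x ÷ ι 2 + ι k) k * binom (x - 1# ÷ ι 2 + ι k) k)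
                     ÷ (binom ((x - 1#) ÷ ι 2 + ι k) k * binom (x - 1# ÷ ι 2 + ι n + ι k) k))
                 * H (2 ℕ.* k) x)
             ≈ (pow (ι 4) n ÷ ι 4
                 * ((binom (x ÷ ι 2 - ι 1 ÷ ι 4 + ι n) n * binom (- (ι 3 ÷ ι 4) + ι n) n)
                     ÷ (binom ((x - 1#) ÷ ι 2 + ι n) n * binom (x - 1# ÷ ι 2 + ι (2 ℕ.* n)) n))
                 * (H n ((x - 1#) ÷ ι 2) - H n (- (ι 3 ÷ ι 4))))
               +
               (pow (ι 4) n ÷ ι 4
                 * ((binom (x ÷ ι 2 - ι 3 ÷ ι 4 + ι n) n * binom (- (ι 5 ÷ ι 4) + ι n) n)
                     ÷ (binom ((x - 1#) ÷ ι 2 + ι n) n * binom (x - 1# ÷ ι 2 + ι (2 ℕ.* n)) n))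
                 * (H n ((x - 1#) ÷ ι 2) - H n (- (ι 5 ÷ ι 4))))
theorem4 F n x x+j≉0 y+j≉0 binom₁≉0 binom₂≉0 = begin
  sumTo n summand                                 ≈⟨ lhs≈ ⟩
  D ⁻¹ * (½ * ½ * W)                              ≈⟨ solve 4 (λ d q A B → d :* (q :* (A :+ B)) := d :* (q :* A) :+ d :* (q :* B)) refl (D ⁻¹) (½ * ½) _ _ ⟩
  D ⁻¹ * (½ * ½ * _) + D ⁻¹ * (½ * ½ * _)         ≈⟨ +-cong (rhs-term≈ _ _ α₁ β₁ γ₁ (+-congʳ (+-congˡ (-‿cong ι1*¼≈½*½))) (+-congʳ (-‿cong (*-congˡ ¼≈½*½))))
                                                            (rhs-term≈ _ _ α₂ β₂ γ₂ (+-congʳ (+-congˡ (-‿cong (*-congˡ ¼≈½*½)))) (+-congʳ (-‿cong (*-congˡ ¼≈½*½)))) ⟨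
  _                                               ∎
  where
  open CharZeroField F
  open FieldOps F
  open ℤ-RingSolver commRing using (solve; _:=_; _:*_; _:+_)
  open DifferentiatedSums F x
  open Identity n x+j≉0 y+j≉0 binom₁≉0 binom₂≉0
  open import Relation.Binary.Reasoning.Setoid setoid
  ι1*¼≈½*½ : ι 1 * ¼ ≈ ½ * ½
  ι1*¼≈½*½ = trans (*-congʳ (+-identityʳ 1#)) (trans (*-identityˡ ¼) ¼≈½*½)
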